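{- For each nondecreasing parking function $\pi$ let $\mathbf P^\pi=\sum_{\mathbf a}\mathbf F_{\mathbf a}\in\mathrm{PQSym}$, the sum running over all parking functions $\mathbf a$ whose nondecreasing rearrangement is $\pi$. The $\mathbf P^\pi$ span a cocommutative Hopf subalgebra $\mathrm{CQSym}$ of $\mathrm{PQSym}$, with $$\mathbf P^{\pi'}\mathbf P^{\pi''}=\mathbf P^{\pi'\bullet\pi''},\qquad \Delta\mathbf P^\pi=\sum_{(u,v)}\mathbf P^{\mathrm{Park}(u)}\otimes\mathbf P^{\mathrm{Park}(v)},$$ where the last sum runs over all pairs $(u,v)$ of nondecreasing words such that the nondecreasing rearrangement of $u\cdot v$ is $\pi$. Moreover, as an algebra, $\mathrm{CQSym}$ is isomorphic to the semigroup algebra of the semigroup of non-crossing partitions under concatenation of diagrams (equivalently, of nondecreasing parking functions under shifted concatenation $\bullet$).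
   Context: Words are finite sequences of positive integers; $|w|$ is the length. For $|u|=k$, $u\bullet v=u\cdot v[k]$ and $u\Cup v$ is the shuffle of $u$ with $v[k]$, where $v[k]$ is $v$ with $k$ added to each letter. A parking function of length $n$ is a word over $\{1,\dots,n\}$ whose nondecreasing rearrangement $a'_1\le\dots\le a'_n$ satisfies $a'_i\le i$. Parkization: for a word $w$ of length $n$, $d(w)=\min\{i\ge1: |\{j:w_j\le i\}|<i\}$; if $d(w)=n+1$ then $\mathrm{Park}(w)=w$, else $\mathrm{Park}(w)=\mathrm{Park}(w')$ with $w'$ obtained by decreasing by $1$ every letter $>d(w)$ (the parkization of a nondecreasing word is nondecreasing). $\mathrm{PQSym}$ is the graded Hopf algebra over a field of characteristic $0$ with basis $(\mathbf F_{\mathbf a})$ indexed by parking functions, product $\mathbf F_{\mathbf a'}\mathbf F_{\mathbf a''}=\sum_{\mathbf a\in\mathbf a'\Cup\mathbf a''}\mathbf F_{\mathbf a}$, coproduct $\Delta\mathbf F_{\mathbf a}=\sum_{u\cdot v=\mathbf a}\mathbf F_{\mathrm{Park}(u)}\otimes\mathbf F_{\mathrm{Park}(v)}$. Non-crossing partitions of $\{1,\dots,n\}$ are in bijection with nondecreasing parking functions of length $n$: replace each element by the minimum of its block and sort nondecreasingly (e.g. $13|2|45\mapsto11244$); under this bijection concatenation of diagrams (placing a partition of $[m]$ to the left of a shifted partition of $[n]$) corresponds to $\bullet$. -}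

module Defs where

open import Level using (Level; _⊔_) renaming (suc to lsuc)
open import Data.Bool using (Bool; true; false; _∧_; T; if_then_else_)
open import Data.Nat using (ℕ; zero; suc; _+_; _∸_; _≤ᵇ_; _<ᵇ_)
open import Data.Nat.Properties using () renaming (_≟_ to _≟ℕ_)
open import Data.List using (List; []; _∷_; _++_; map; concatMap; length; filter; foldr; upTo; applyUpTo)
open import Data.Nat.ListAction using (sum)
open import Data.List.Properties using (≡-dec)
open import Data.List.Relation.Unary.All using (All)
open import Data.Product using (Σ; _×_; _,_; proj₁; proj₂)
open import Relation.Nullary using (¬_; does)
open import Relation.Binary.PropositionalEquality using (_≡_)
open import Algebra.Bundles using (CommutativeRing)

natEmb : ∀ {c ℓ} (R : CommutativeRing c ℓ) → ℕ → CommutativeRing.Carrier R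
natEmb R zero    = CommutativeRing.0# R
natEmb R (suc n) = CommutativeRing._+_ R (CommutativeRing.1# R) (natEmb R n)

record CharZeroField (c ℓ : Level) : Set (lsuc (c ⊔ ℓ)) where
  field
    commutativeRing : CommutativeRing c ℓ
  open CommutativeRing commutativeRing
  field
    nontrivial : ¬ (1# ≈ 0#)
    inverse    : ∀ x → ¬ (x ≈ 0#) → Σ Carrier λ y → x * y ≈ 1#
    charZero   : ∀ n → natEmb commutativeRing n ≈ 0# → n ≡ 0

Word : Set
Word = List ℕ

_==_ : Word → Word → Bool
u == v = does (≡-dec _≟ℕ_ u v)

shift : ℕ → Word → Word
shift k v = map (k +_) v

_•_ : Word → Word → Word
u • v = u ++ shift (length u) v

shuffle : Word → Word → List Word
shuffle []       v        = v ∷ []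
shuffle (x ∷ u)  []       = (x ∷ u) ∷ []
shuffle (x ∷ u)  (y ∷ v)  =
  map (x ∷_) (shuffle u (y ∷ v)) ++ map (y ∷_) (shuffle (x ∷ u) v)

_⋒_ : Word → Word → List Word
u ⋒ v = shuffle u (shift (length u) v)

insert : ℕ → Word → Word
insert x []       = x ∷ []
insert x (y ∷ ys) = if x ≤ᵇ y then x ∷ y ∷ ys else y ∷ insert x ys

sort : Word → Word
sort = foldr insert []

isNondecreasing : Word → Bool
isNondecreasing []           = true
isNondecreasing (x ∷ [])     = true
isNondecreasing (x ∷ y ∷ ys) = (x ≤ᵇ y) ∧ isNondecreasing (y ∷ ys)

boundedFrom : ℕ → Word → Bool
boundedFrom i []       = true
boundedFrom i (x ∷ xs) = (1 ≤ᵇ x) ∧ (x ≤ᵇ i) ∧ boundedFrom (suc i) xs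

-- parking function (a word over {1..n}, n = length, with a'_i ≤ i)
isPF : Word → Bool
isPF w = boundedFrom 1 (sort w)

IsNDPF : Word → Set
IsNDPF π = T (isPF π) × T (isNondecreasing π)

NDPF : Set
NDPF = Σ Word IsNDPF

words : ℕ → ℕ → List Word
words zero      m = [] ∷ []
words (suc len) m = concatMap (λ x → map (x ∷_) (words len m)) (applyUpTo suc m)

PFs : ℕ → List Word
PFs n = filter (λ a → isPF a Data.Bool.≟ true) (words n n)
  where import Data.Bool

count≤ : ℕ → Word → ℕ
count≤ i w = length (filter (λ x → x Data.Nat.≤? i) w)
  where import Data.Nat

-- d(w) = min { i ≥ 1 : |{j : w_j ≤ i}| < i }, searched among 1..n+1
-- (it is always ≤ n+1)
dsearch : ℕ → ℕ → Word → ℕ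
dsearch i zero      w = i
dsearch i (suc k)   w = if count≤ i w <ᵇ i then i else dsearch (suc i) k w

d : Word → ℕ
d w = dsearch 1 (length w) w

decAbove : ℕ → Word → Word
decAbove t = map (λ x → if t <ᵇ x then x ∸ 1 else x)

-- Park with fuel: every non-final step strictly decreases the sum of the
-- letters, so fuel = sum w is always enough.
parkFuel : ℕ → Word → Word
parkFuel zero    w = w
parkFuel (suc f) w with d w Data.Nat.≟ suc (length w)
  where import Data.Nat
... | Relation.Nullary.yes _ = w
... | Relation.Nullary.no  _ = parkFuel f (decAbove (d w) w)

Park : Word → Word
Park w = parkFuel (sum w) w

splits : Word → List (Word × Word)
splits []       = ([] , []) ∷ []
splits (x ∷ w)  = ([] , x ∷ w) ∷ map (λ p → (x ∷ proj₁ p , proj₂ p)) (splits w)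

-- all pairs (u , v) of nondecreasing words such that the nondecreasing
-- rearrangement of u · v is π (their letters necessarily lie in {1..|π|})
ndPairs : Word → List (Word × Word)
ndPairs π =
  concatMap (λ k →
    concatMap (λ u →
      concatMap (λ v →
        if isNondecreasing u ∧ isNondecreasing v ∧ (sort (u ++ v) == π)
        then (u , v) ∷ [] else [])
      (words (n ∸ k) n))
    (words k n))
  (upTo (suc n))
  where n = length π

-- PQSym over a commutative ring, with basis F_a (a parking function).
-- Elements are finite formal linear combinations, compared coefficientwise.

module PQSym {c ℓ} (R : CommutativeRing c ℓ) where
  open CommutativeRing R hiding (_+_; _*_)
  open CommutativeRing R using () renaming (_+_ to _+ᴿ_; _*_ to _*ᴿ_)

  Lin : Set c
  Lin = List (Carrier × Word)

  Lin₂ : Set c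
  Lin₂ = List (Carrier × Word × Word)

  Σ' : List Carrier → Carrier
  Σ' = foldr _+ᴿ_ 0#

  coeff : Lin → Word → Carrier
  coeff x w = Σ' (map (λ p → if proj₂ p == w then proj₁ p else 0#) x)

  coeff₂ : Lin₂ → Word → Word → Carrier
  coeff₂ x u v = Σ' (map (λ p → if (proj₁ (proj₂ p) == u) ∧ (proj₂ (proj₂ p) == v)
                                 then proj₁ p else 0#) x)

  infix 4 _≋_ _≋₂_
  _≋_ : Lin → Lin → Set ℓ
  x ≋ y = ∀ w → coeff x w ≈ coeff y w

  _≋₂_ : Lin₂ → Lin₂ → Set ℓ
  x ≋₂ y = ∀ u v → coeff₂ x u v ≈ coeff₂ y u v

  F : Word → Lin
  F a = (1# , a) ∷ []

  scale : Carrier → Lin → Lin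
  scale k = map (λ p → (k *ᴿ proj₁ p , proj₂ p))

  one : Lin
  one = F []

  _⊛_ : Lin → Lin → Lin
  x ⊛ y = concatMap (λ p → concatMap (λ q →
            map (λ a → (proj₁ p *ᴿ proj₁ q , a)) (proj₂ p ⋒ proj₂ q)) y) x

  Δ : Lin → Lin₂
  Δ x = concatMap (λ p → map (λ uv → (proj₁ p , Park (proj₁ uv) , Park (proj₂ uv)))
                              (splits (proj₂ p))) x

  _⊗_ : Lin → Lin → Lin₂
  x ⊗ y = concatMap (λ p → map (λ q → (proj₁ p *ᴿ proj₁ q , proj₂ p , proj₂ q)) y) x

  swap₂ : Lin₂ → Lin₂
  swap₂ = map (λ p → (proj₁ p , proj₂ (proj₂ p) , proj₁ (proj₂ p)))

  P : Word → Lin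
  P π = map (λ a → (1# , a)) (filter (λ a → (sort a == π) Data.Bool.≟ true) (PFs (length π)))
    where import Data.Bool

  -- the semigroup algebra of (NDPF, •): finite formal combinations Σ c_i [π_i]
  -- of nondecreasing parking functions π_i (validity recorded by ValidS)
  SAlg : Set c
  SAlg = List (Carrier × Word)

  ValidS : SAlg → Set c
  ValidS s = All (λ p → IsNDPF (proj₂ p)) s

  coeffS : SAlg → Word → Carrier
  coeffS x π = Σ' (map (λ p → if proj₂ p == π then proj₁ p else 0#) x)

  infix 4 _≈S_
  _≈S_ : SAlg → SAlg → Set ℓ
  x ≈S y = ∀ π → coeffS x π ≈ coeffS y π

  scaleS : Carrier → SAlg → SAlg
  scaleS k = map (λ p → (k *ᴿ proj₁ p , proj₂ p))

  oneS : SAlg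
  oneS = (1# , []) ∷ []

  _⋆_ : SAlg → SAlg → SAlg
  x ⋆ y = concatMap (λ p → map (λ q → (proj₁ p *ᴿ proj₁ q , proj₂ p • proj₂ q)) y) x

  linP : SAlg → Lin
  linP = concatMap (λ p → scale (proj₁ p) (P (proj₂ p)))

  InCQSym : Lin → Set (c ⊔ ℓ)
  InCQSym x = Σ SAlg λ s → ValidS s × x ≋ linP s

  InCQSym₂ : Lin₂ → Set (c ⊔ ℓ)
  InCQSym₂ x = Σ (List (Carrier × Word × Word)) λ s →
    All (λ p → IsNDPF (proj₁ (proj₂ p)) × IsNDPF (proj₂ (proj₂ p))) s ×
    x ≋₂ concatMap (λ p → map (λ q → (proj₁ p *ᴿ proj₁ q , proj₂ q))
                                (P (proj₁ (proj₂ p)) ⊗ P (proj₂ (proj₂ p)))) s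

-- Every claim is an identity between coefficients, and every coefficient turns out to be the image
-- of a count of words, so nothing beyond a commutative ring of scalars is used.
-- Product: a shuffle w of a' with a''[k], k = |π'|, determines a' and a'' as its subwords of letters
-- ≤ k and > k, so F_w occurs in P^π' P^π'' exactly once when these subwords sort to π' and π''[k],
-- that is, when w sorts to π' • π'', and not at all otherwise.
-- Coproduct: the coefficient of F_a ⊗ F_b in Δ P^π counts the factorizations x · y of rearrangements
-- of π with Park x = a and Park y = b. Group them by u = sort x and v = sort y. On the rearrangements
-- of a nondecreasing u, parkization is a single relabelling of letters, injective on the letters of u,
-- so exactly one x with sort x = u parks to a if a rearranges Park u, and none otherwise: this is the
-- coefficient of F_a in P^Park(u). Exchanging x and y preserves the rearrangement class of x · y,
-- which gives cocommutativity.
-- Finally P^π has coefficient 1 at F_π and 0 at every other nondecreasing word, so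
-- Σ c_i [π_i] ↦ Σ c_i P^π_i is injective on the semigroup algebra.

module Submission where

open import Defs
open import Data.List using (List; _++_; concatMap)
open import Data.Product using (Σ; _×_; _,_; proj₁; proj₂)
open import Algebra.Bundles using (CommutativeRing)

module Combinatorics where

  open import Data.Bool using (Bool; true; false; _∧_; T; if_then_else_) renaming (_≟_ to _≟B_)
  open import Data.Empty using (⊥-elim)
  open import Data.List using (List; []; _∷_; _++_; map; filter; length; concatMap; applyUpTo; upTo; _∷ʳ_; take; drop)
  open import Data.List.Membership.Propositional using (_∈_)
  open import Data.List.Membership.Propositional.Properties using (∈-map⁺)
  open import Data.List.Properties using (≡-dec; map-∘; map-id; map-id-local; map-cong; ++-identityʳ; length-map; map-upTo; upTo-∷ʳ; ∷-injectiveˡ; ∷-injectiveʳ)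
  open import Data.List.Relation.Binary.Permutation.Propositional using (_↭_; ↭-sym; ↭-trans; ↭-refl; prep; swap)
  open import Data.List.Relation.Binary.Permutation.Propositional.Properties using (All-resp-↭; ↭-length; filter-↭; map⁺; ∈-resp-↭; ++⁺; drop-∷; ++-comm)
  open import Data.List.Relation.Unary.All using (All; []; _∷_)
  import Data.List.Relation.Unary.All as All
  import Data.List.Relation.Unary.All.Properties as AllP
  open import Data.List.Relation.Unary.Any using (Any; here; there)
  open import Data.Nat using (ℕ; zero; suc; _+_; _*_; _∸_; _≤_; _<_; _≤ᵇ_; _<ᵇ_; _≡ᵇ_; z≤n; s≤s; _≟_; _≤?_; _<?_; s≤s⁻¹)
  open import Data.Nat.ListAction using (sum)
  open import Data.Nat.ListAction.Properties using (sum-↭)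
  open import Data.Nat.Properties
  open import Algebra.Properties.CommutativeSemigroup +-commutativeSemigroup using () renaming (interchange to +-interchange)
  open import Data.Product using (_×_; _,_; proj₁; proj₂)
  open import Data.Sum using (_⊎_; inj₁; inj₂)
  open import Function using (_∘_; id)
  open import Relation.Binary.Definitions using (tri<; tri≈; tri>)
  open import Relation.Binary.PropositionalEquality hiding ([_])
  open import Relation.Nullary using (yes; no; ¬_; Dec; does)
  open import Relation.Nullary.Decidable using (dec-true; dec-false)
  open import Relation.Unary using (Pred; Decidable)

  data Sorted : Word → Set where
    sorted[] : Sorted []
    sorted∷ : ∀ {x xs} → All (x ≤_) xs → Sorted xs → Sorted (x ∷ xs)

  All≤-weaken : ∀ {x y xs} → x ≤ y → All (y ≤_) xs → All (x ≤_) xs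
  All≤-weaken p [] = []
  All≤-weaken p (q ∷ qs) = ≤-trans p q ∷ All≤-weaken p qs

  T∧₁ : ∀ a b → T (a ∧ b) → T a
  T∧₁ true b t = _
  T∧₂ : ∀ a b → T (a ∧ b) → T b
  T∧₂ true b t = t
  T∧-intro : ∀ {a b} → T a → T b → T (a ∧ b)
  T∧-intro {true} _ t = t

  nondecreasing⇒Sorted : ∀ w → T (isNondecreasing w) → Sorted w
  nondecreasing⇒Sorted [] t = sorted[]
  nondecreasing⇒Sorted (x ∷ []) t = sorted∷ [] sorted[]
  nondecreasing⇒Sorted (x ∷ y ∷ ys) t with nondecreasing⇒Sorted (y ∷ ys) (T∧₂ (x ≤ᵇ y) _ t)
  ... | sorted∷ a s = let p = ≤ᵇ⇒≤ x y (T∧₁ (x ≤ᵇ y) _ t) in sorted∷ (p ∷ All≤-weaken p a) (sorted∷ a s)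

  Sorted⇒nondecreasing : ∀ w → Sorted w → T (isNondecreasing w)
  Sorted⇒nondecreasing [] s = _
  Sorted⇒nondecreasing (x ∷ []) s = _
  Sorted⇒nondecreasing (x ∷ y ∷ ys) (sorted∷ (p ∷ _) s) = T∧-intro (≤⇒≤ᵇ p) (Sorted⇒nondecreasing (y ∷ ys) s)

  insert-↭ : ∀ x ys → insert x ys ↭ x ∷ ys
  insert-↭ x [] = ↭-refl
  insert-↭ x (y ∷ ys) with x ≤ᵇ y
  ... | true = ↭-refl
  ... | false = ↭-trans (prep y (insert-↭ x ys)) (swap y x ↭-refl)

  sort-↭ : ∀ w → sort w ↭ w
  sort-↭ [] = ↭-refl
  sort-↭ (x ∷ w) = ↭-trans (insert-↭ x (sort w)) (prep x (sort-↭ w))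

  All-insert : ∀ {P : ℕ → Set} {x ys} → P x → All P ys → All P (insert x ys)
  All-insert {P} {x} {ys} px a = All-resp-↭ (↭-sym (insert-↭ x ys)) (px ∷ a)

  insert-sorted : ∀ x ys → Sorted ys → Sorted (insert x ys)
  insert-sorted x [] s = sorted∷ [] sorted[]
  insert-sorted x (y ∷ ys) (sorted∷ a s) with x ≤ᵇ y in eq
  ... | true = let p = ≤ᵇ⇒≤ x y (subst T (sym eq) _) in sorted∷ (p ∷ All≤-weaken p a) (sorted∷ a s)
  ... | false = sorted∷ (All-insert (<⇒≤ (≰⇒> (λ q → subst T eq (≤⇒≤ᵇ q)))) a) (insert-sorted x ys s)

  sort-sorted : ∀ w → Sorted (sort w)
  sort-sorted [] = sorted[]
  sort-sorted (x ∷ w) = insert-sorted x (sort w) (sort-sorted w)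

  sorted-unique : ∀ {xs ys} → Sorted xs → Sorted ys → xs ↭ ys → xs ≡ ys
  sorted-unique sorted[] sorted[] p = refl
  sorted-unique sorted[] (sorted∷ _ _) p with ↭-length p
  ... | ()
  sorted-unique (sorted∷ _ _) sorted[] p with ↭-length p
  ... | ()
  sorted-unique {x ∷ xs} {y ∷ ys} (sorted∷ a s) (sorted∷ b t) p = goal
    where
    x∈ : x ∈ y ∷ ys
    x∈ = ∈-resp-↭ p (here refl)
    y∈ : y ∈ x ∷ xs
    y∈ = ∈-resp-↭ (↭-sym p) (here refl)
    y≤x : y ≤ x
    y≤x with x∈
    ... | here e = ≤-reflexive (sym e)
    ... | there i = All.lookup b i
    x≤y : x ≤ y
    x≤y with y∈
    ... | here e = ≤-reflexive (sym e)
    ... | there i = All.lookup a i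
    x≡y : x ≡ y
    x≡y = ≤-antisym x≤y y≤x
    goal : x ∷ xs ≡ y ∷ ys
    goal rewrite x≡y = cong (y ∷_) (sorted-unique s t (drop-∷ (subst (λ z → z ∷ xs ↭ y ∷ ys) x≡y p)))

  sort-cong : ∀ {xs ys} → xs ↭ ys → sort xs ≡ sort ys
  sort-cong {xs} {ys} p = sorted-unique (sort-sorted xs) (sort-sorted ys) (↭-trans (sort-↭ xs) (↭-trans p (↭-sym (sort-↭ ys))))

  sort-of-sorted : ∀ {xs} → Sorted xs → sort xs ≡ xs
  sort-of-sorted {xs} s = sorted-unique (sort-sorted xs) s (sort-↭ xs)

  Monotone : (ℕ → ℕ) → Set
  Monotone G = ∀ {x y} → x ≤ y → G x ≤ G y

  sorted-map : ∀ G → Monotone G → ∀ {xs} → Sorted xs → Sorted (map G xs)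
  sorted-map G m sorted[] = sorted[]
  sorted-map G m (sorted∷ a s) = sorted∷ (AllP.map⁺ (All.map m a)) (sorted-map G m s)

  sort-map : ∀ G → Monotone G → ∀ xs → sort (map G xs) ≡ map G (sort xs)
  sort-map G m xs = sorted-unique (sort-sorted (map G xs)) (sorted-map G m (sort-sorted xs))
    (↭-trans (sort-↭ (map G xs)) (map⁺ G (↭-sym (sort-↭ xs))))

  sorted-filter : ∀ {q} {Q : Pred ℕ q} (Q? : Decidable Q) {xs} → Sorted xs → Sorted (filter Q? xs)
  sorted-filter Q? sorted[] = sorted[]
  sorted-filter Q? {x ∷ xs} (sorted∷ a s) with Q? x
  ... | yes _ = sorted∷ (AllP.filter⁺ Q? a) (sorted-filter Q? s)
  ... | no _ = sorted-filter Q? s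

  sort-filter : ∀ {q} {Q : Pred ℕ q} (Q? : Decidable Q) xs → sort (filter Q? xs) ≡ filter Q? (sort xs)
  sort-filter Q? xs = sorted-unique (sort-sorted (filter Q? xs)) (sorted-filter Q? (sort-sorted xs))
    (↭-trans (sort-↭ (filter Q? xs)) (filter-↭ Q? (↭-sym (sort-↭ xs))))

  sort-++-comm : ∀ xs ys → sort (xs ++ ys) ≡ sort (ys ++ xs)
  sort-++-comm xs ys = sort-cong (++-comm xs ys)

  sort-length : ∀ xs → length (sort xs) ≡ length xs
  sort-length xs = ↭-length (sort-↭ xs)

  ==-refl : ∀ u → (u == u) ≡ true
  ==-refl u = dec-true (≡-dec _≟_ u u) refl

  ==-ne : ∀ u v → u ≢ v → (u == v) ≡ false
  ==-ne u v = dec-false (≡-dec _≟_ u v)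

  ==-sound : ∀ u v → (u == v) ≡ true → u ≡ v
  ==-sound u v e with ≡-dec _≟_ u v
  ... | yes p = p
  ==-sound u v () | no _

  ==-sym : ∀ u v → (u == v) ≡ (v == u)
  ==-sym u v with ≡-dec _≟_ u v | ≡-dec _≟_ v u
  ... | yes _ | yes _ = refl
  ... | no _ | no _ = refl
  ... | yes p | no q = ⊥-elim (q (sym p))
  ... | no p | yes q = ⊥-elim (p (sym q))

  does-sound : ∀ {a} {P : Set a} (d : Dec P) → does d ≡ true → P
  does-sound (yes p) _ = p
  does-sound (no _) ()

  bool-ext : ∀ {b c : Bool} → (b ≡ true → c ≡ true) → (c ≡ true → b ≡ true) → b ≡ c
  bool-ext {true} {true} f g = refl
  bool-ext {true} {false} f g = sym (f refl)
  bool-ext {false} {true} f g = g refl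
  bool-ext {false} {false} f g = refl

  ∧-true : ∀ {a b} → a ≡ true → b ≡ true → (a ∧ b) ≡ true
  ∧-true refl refl = refl

  ∧-true₁ : ∀ a b → (a ∧ b) ≡ true → a ≡ true
  ∧-true₁ true b _ = refl
  ∧-true₂ : ∀ a b → (a ∧ b) ≡ true → b ≡ true
  ∧-true₂ true b e = e

  ==-∷ : ∀ x y v w → ((x ∷ v) == (y ∷ w)) ≡ (does (x ≟ y) ∧ (v == w))
  ==-∷ x y v w = bool-ext into from
    where
    into : ((x ∷ v) == (y ∷ w)) ≡ true → (does (x ≟ y) ∧ (v == w)) ≡ true
    into e with ==-sound (x ∷ v) (y ∷ w) e
    ... | refl = ∧-true (dec-true (x ≟ x) refl) (==-refl v)
    from : (does (x ≟ y) ∧ (v == w)) ≡ true → ((x ∷ v) == (y ∷ w)) ≡ true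
    from e with does-sound (x ≟ y) (∧-true₁ _ _ e) | ==-sound v w (∧-true₂ (does (x ≟ y)) _ e)
    ... | refl | refl = ==-refl (x ∷ v)

  [_] : Bool → ℕ
  [ b ] = if b then 1 else 0

  sumN : ∀ {a} {X : Set a} → (X → ℕ) → List X → ℕ
  sumN f [] = 0
  sumN f (x ∷ xs) = f x + sumN f xs

  [∧] : ∀ a b → [ a ∧ b ] ≡ [ a ] * [ b ]
  [∧] true b = sym (+-identityʳ [ b ])
  [∧] false b = refl

  sumN-0 : ∀ {a} {X : Set a} (f : X → ℕ) xs → (∀ x → f x ≡ 0) → sumN f xs ≡ 0
  sumN-0 f [] e = refl
  sumN-0 f (x ∷ xs) e rewrite e x = sumN-0 f xs e

  sumN-ext : ∀ {a} {X : Set a} {f g : X → ℕ} → (∀ x → f x ≡ g x) → ∀ xs → sumN f xs ≡ sumN g xs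
  sumN-ext e [] = refl
  sumN-ext e (x ∷ xs) = cong₂ _+_ (e x) (sumN-ext e xs)

  sumN-All : ∀ {a} {X : Set a} {f g : X → ℕ} {xs} → All (λ x → f x ≡ g x) xs → sumN f xs ≡ sumN g xs
  sumN-All [] = refl
  sumN-All (e ∷ es) = cong₂ _+_ e (sumN-All es)

  sumN-++ : ∀ {a} {X : Set a} (f : X → ℕ) xs ys → sumN f (xs ++ ys) ≡ sumN f xs + sumN f ys
  sumN-++ f [] ys = refl
  sumN-++ f (x ∷ xs) ys rewrite sumN-++ f xs ys = sym (+-assoc (f x) _ _)

  sumN-map : ∀ {a b} {X : Set a} {Y : Set b} (f : Y → ℕ) (g : X → Y) xs → sumN f (map g xs) ≡ sumN (λ x → f (g x)) xs
  sumN-map f g [] = refl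
  sumN-map f g (x ∷ xs) = cong (f (g x) +_) (sumN-map f g xs)

  sumN-concatMap : ∀ {a b} {X : Set a} {Y : Set b} (f : Y → ℕ) (g : X → List Y) xs →
    sumN f (concatMap g xs) ≡ sumN (λ x → sumN f (g x)) xs
  sumN-concatMap f g [] = refl
  sumN-concatMap f g (x ∷ xs) = trans (sumN-++ f (g x) (concatMap g xs)) (cong (sumN f (g x) +_) (sumN-concatMap f g xs))

  sumN-filter : ∀ {a p} {X : Set a} {P : Pred X p} (P? : Decidable P) (f : X → ℕ) xs →
    sumN f (filter P? xs) ≡ sumN (λ x → [ does (P? x) ] * f x) xs
  sumN-filter P? f [] = refl
  sumN-filter P? f (x ∷ xs) with P? x
  ... | yes _ = cong₂ _+_ (sym (+-identityʳ (f x))) (sumN-filter P? f xs)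
  ... | no _ = sumN-filter P? f xs

  sumN-+ : ∀ {a} {X : Set a} (f g : X → ℕ) xs → sumN (λ x → f x + g x) xs ≡ sumN f xs + sumN g xs
  sumN-+ f g [] = refl
  sumN-+ f g (x ∷ xs) rewrite sumN-+ f g xs = +-interchange (f x) (g x) (sumN f xs) (sumN g xs)

  sumN-*ˡ : ∀ {a} {X : Set a} k (f : X → ℕ) xs → k * sumN f xs ≡ sumN (λ x → k * f x) xs
  sumN-*ˡ k f [] = *-zeroʳ k
  sumN-*ˡ k f (x ∷ xs) = trans (*-distribˡ-+ k (f x) (sumN f xs)) (cong (k * f x +_) (sumN-*ˡ k f xs))

  sumN-*ʳ : ∀ {a} {X : Set a} k (f : X → ℕ) xs → sumN f xs * k ≡ sumN (λ x → f x * k) xs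
  sumN-*ʳ k f xs = trans (*-comm (sumN f xs) k) (trans (sumN-*ˡ k f xs) (sumN-ext (λ x → *-comm k (f x)) xs))

  sumN-swap : ∀ {a b} {X : Set a} {Y : Set b} (f : X → Y → ℕ) xs ys →
    sumN (λ x → sumN (f x) ys) xs ≡ sumN (λ y → sumN (λ x → f x y) xs) ys
  sumN-swap f [] ys = sym (sumN-0 _ ys (λ _ → refl))
  sumN-swap f (x ∷ xs) ys = trans (cong (sumN (f x) ys +_) (sumN-swap f xs ys)) (sym (sumN-+ (f x) (λ y → sumN (λ x' → f x' y) xs) ys))

  multiplicity : Word → List Word → ℕ
  multiplicity w = sumN (λ v → [ v == w ])

  sumN-indicator : ∀ w (g : Word → ℕ) L → sumN (λ v → [ v == w ] * g v) L ≡ multiplicity w L * g w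
  sumN-indicator w g [] = refl
  sumN-indicator w g (v ∷ L) with v == w in eq
  ... | true rewrite ==-sound v w eq | sumN-indicator w g L = trans (cong (_+ (multiplicity w L * g w)) (+-identityʳ (g w))) refl
  ... | false = sumN-indicator w g L

  sumN-upTo-suc : ∀ (h : ℕ → ℕ) n → sumN h (upTo (suc n)) ≡ sumN h (upTo n) + h n
  sumN-upTo-suc h n = trans (cong (sumN h) (sym (upTo-∷ʳ n))) (trans (sumN-++ h (upTo n) (n ∷ [])) (cong (sumN h (upTo n) +_) (+-identityʳ (h n))))

  sumN-upTo-indicator-in : ∀ (h : ℕ → ℕ) n j → j < n → sumN (λ i → [ does (i ≟ j) ] * h i) (upTo n) ≡ h j
  sumN-upTo-indicator-out : ∀ (h : ℕ → ℕ) n j → n ≤ j → sumN (λ i → [ does (i ≟ j) ] * h i) (upTo n) ≡ 0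
  sumN-upTo-indicator-in h (suc n) j j<sn rewrite sumN-upTo-suc (λ i → [ does (i ≟ j) ] * h i) n with j ≟ n
  ... | yes refl rewrite sumN-upTo-indicator-out h n n ≤-refl | dec-true (n ≟ n) refl = +-identityʳ (h n)
  ... | no j≢n rewrite sumN-upTo-indicator-in h n j (≤∧≢⇒< (s≤s⁻¹ j<sn) j≢n) | dec-false (n ≟ j) (λ e → j≢n (sym e)) = +-identityʳ (h j)
  sumN-upTo-indicator-out h zero j _ = refl
  sumN-upTo-indicator-out h (suc n) j sn≤j rewrite sumN-upTo-suc (λ i → [ does (i ≟ j) ] * h i) n
    | sumN-upTo-indicator-out h n j (≤-trans (n≤1+n n) sn≤j) | dec-false (n ≟ j) (λ e → <-irrefl e sn≤j) = refl

  InWords : ℕ → ℕ → Word → Set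
  InWords n m w = length w ≡ n × All (λ x → 1 ≤ x × x ≤ m) w

  sumN-letters-indicator : ∀ m (h : ℕ → ℕ) y → sumN (λ x → [ does (x ≟ y) ] * h x) (applyUpTo suc m)
    ≡ (if does (1 ≤? y) ∧ does (y ≤? m) then h y else 0)
  sumN-letters-indicator m h y = trans (cong (sumN _) (sym (map-upTo suc m)))
    (trans (sumN-map (λ x → [ does (x ≟ y) ] * h x) suc (upTo m)) (shifted y))
    where
    shifted : ∀ y → sumN (λ i → [ does (suc i ≟ y) ] * h (suc i)) (upTo m) ≡ (if does (1 ≤? y) ∧ does (y ≤? m) then h y else 0)
    shifted zero = sumN-0 _ (upTo m) (λ i → refl)
    shifted (suc j) with j <? m
    ... | yes j<m rewrite dec-true (suc j ≤? m) j<m = sumN-upTo-indicator-in (λ i → h (suc i)) m j j<m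
    ... | no j≮m rewrite dec-false (suc j ≤? m) j≮m = sumN-upTo-indicator-out (λ i → h (suc i)) m j (≮⇒≥ j≮m)

  multiplicity-words : ∀ n m w → InWords n m w → multiplicity w (words n m) ≡ 1
  multiplicity-words zero m [] _ = refl
  multiplicity-words (suc n) m (y ∷ w) (len , ((1≤y , y≤m) ∷ a)) =
    begin
      multiplicity (y ∷ w) (words (suc n) m)
    ≡⟨ sumN-concatMap (λ v → [ v == (y ∷ w) ]) (λ x → map (x ∷_) (words n m)) (applyUpTo suc m) ⟩
      sumN (λ x → sumN (λ v → [ v == (y ∷ w) ]) (map (x ∷_) (words n m))) (applyUpTo suc m)
    ≡⟨ sumN-ext (λ x → trans (sumN-map _ (x ∷_) (words n m))
          (trans (sumN-ext (λ v → trans (cong [_] (==-∷ x y v w)) ([∧] (does (x ≟ y)) (v == w))) (words n m))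
            (sym (sumN-*ˡ [ does (x ≟ y) ] _ (words n m))))) (applyUpTo suc m) ⟩
      sumN (λ x → [ does (x ≟ y) ] * multiplicity w (words n m)) (applyUpTo suc m)
    ≡⟨ sumN-letters-indicator m (λ _ → multiplicity w (words n m)) y ⟩
      (if does (1 ≤? y) ∧ does (y ≤? m) then multiplicity w (words n m) else 0)
    ≡⟨ cong₂ (λ a b → if a ∧ b then multiplicity w (words n m) else 0) (dec-true (1 ≤? y) 1≤y) (dec-true (y ≤? m) y≤m) ⟩
      multiplicity w (words n m)
    ≡⟨ multiplicity-words n m w (suc-injective len , a) ⟩
      1
    ∎
    where open ≡-Reasoning

  PFsOf : Word → List Word
  PFsOf π = filter (λ a → (sort a == π) ≟B true) (PFs (length π))

  does≟true : ∀ b → does (b ≟B true) ≡ b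
  does≟true true = refl
  does≟true false = refl

  T⇒≡true : ∀ {b} → T b → b ≡ true
  T⇒≡true {true} _ = refl

  ≡true⇒T : ∀ {b} → b ≡ true → T b
  ≡true⇒T refl = _

  All-<-cong : ∀ {a b : ℕ} → a ≡ b → ∀ {xs} → All (λ x → 1 ≤ x × x < a) xs → All (λ x → 1 ≤ x × x < b) xs
  All-<-cong refl p = p

  boundedFrom-letters : ∀ i xs → T (boundedFrom i xs) → All (λ x → 1 ≤ x × x < length xs + i) xs
  boundedFrom-letters i [] t = []
  boundedFrom-letters i (x ∷ xs) t =
    (≤ᵇ⇒≤ 1 x (T∧₁ (1 ≤ᵇ x) r t) , s≤s (≤-trans (≤ᵇ⇒≤ x i (T∧₁ (x ≤ᵇ i) b (T∧₂ (1 ≤ᵇ x) r t))) (m≤n+m i (length xs))))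
    ∷ All-<-cong (+-suc (length xs) i) (boundedFrom-letters (suc i) xs (T∧₂ (x ≤ᵇ i) b (T∧₂ (1 ≤ᵇ x) r t)))
    where b = boundedFrom (suc i) xs
          r = (x ≤ᵇ i) ∧ b

  All-<suc⇒≤ : ∀ {n xs} → All (λ x → 1 ≤ x × x < suc n) xs → All (λ x → 1 ≤ x × x ≤ n) xs
  All-<suc⇒≤ [] = []
  All-<suc⇒≤ ((a , b) ∷ r) = (a , s≤s⁻¹ b) ∷ All-<suc⇒≤ r

  isPF-letters : ∀ w → T (isPF w) → All (λ x → 1 ≤ x × x ≤ length w) w
  isPF-letters w t = All-resp-↭ (sort-↭ w) (All-<suc⇒≤ (All-<-cong (trans (+-comm _ 1) (cong suc (sort-length w))) (boundedFrom-letters 1 (sort w) t)))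

  IsNDPF-sort : ∀ {π} → IsNDPF π → sort π ≡ π
  IsNDPF-sort {π} (_ , nd) = sort-of-sorted (nondecreasing⇒Sorted π nd)

  isPF-of-sort : ∀ {w σ} → IsNDPF σ → sort w ≡ σ → isPF w ≡ true
  isPF-of-sort {w} {σ} (pf , nd) e = trans (cong (boundedFrom 1) (trans e (sym (IsNDPF-sort (pf , nd))))) (T⇒≡true pf)

  sumN-PFsOf : ∀ σ → IsNDPF σ → (f : Word → ℕ) →
    sumN f (PFsOf σ) ≡ sumN (λ w → [ sort w == σ ] * f w) (words (length σ) (length σ))
  sumN-PFsOf σ h f = trans (sumN-filter Q₂ f (PFs n)) (trans (sumN-filter Q₁ _ (words n n)) (sumN-ext term (words n n)))
    where
    n = length σ
    Q₁ = λ a → isPF a ≟B true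
    Q₂ = λ a → (sort a == σ) ≟B true
    term : ∀ w → [ does (Q₁ w) ] * ([ does (Q₂ w) ] * f w) ≡ [ sort w == σ ] * f w
    term w rewrite does≟true (isPF w) | does≟true (sort w == σ) with sort w == σ in e
    ... | false = *-zeroʳ [ isPF w ]
    ... | true = trans (cong (λ b → [ b ] * (f w + 0)) (isPF-of-sort {w} {σ} h (==-sound (sort w) σ e))) (+-identityʳ _)

  multiplicity-PFsOf-NDPF : ∀ σ → IsNDPF σ → ∀ w → multiplicity w (PFsOf σ) ≡ [ sort w == σ ]
  multiplicity-PFsOf-NDPF σ h w =
    begin
      multiplicity w (PFsOf σ)
    ≡⟨ sumN-PFsOf σ h _ ⟩
      sumN (λ v → [ sort v == σ ] * [ v == w ]) (words n n)
    ≡⟨ sumN-ext (λ v → *-comm [ sort v == σ ] _) (words n n) ⟩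
      sumN (λ v → [ v == w ] * [ sort v == σ ]) (words n n)
    ≡⟨ sumN-indicator w (λ v → [ sort v == σ ]) (words n n) ⟩
      multiplicity w (words n n) * [ sort w == σ ]
    ≡⟨ counted-once ⟩
      [ sort w == σ ]
    ∎
    where
    open ≡-Reasoning
    n = length σ
    counted-once : multiplicity w (words n n) * [ sort w == σ ] ≡ [ sort w == σ ]
    counted-once with sort w == σ in e
    ... | false = *-zeroʳ (multiplicity w (words n n))
    ... | true = cong (_* 1) (multiplicity-words n n w (len , subst (λ k → All (λ x → 1 ≤ x × x ≤ k) w) len letters))
      where
      len : length w ≡ length σ
      len = trans (sym (sort-length w)) (cong length (==-sound (sort w) σ e))
      letters = isPF-letters w (≡true⇒T (isPF-of-sort {w} {σ} h (==-sound (sort w) σ e)))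

  -- Shuffles and shifted concatenation

  below : ℕ → Word → Word
  below k [] = []
  below k (x ∷ xs) = if x ≤ᵇ k then x ∷ below k xs else below k xs
  above : ℕ → Word → Word
  above k [] = []
  above k (x ∷ xs) = if x ≤ᵇ k then above k xs else x ∷ above k xs

  ≤ᵇ≡true⇒≤ : ∀ {x k} → (x ≤ᵇ k) ≡ true → x ≤ k
  ≤ᵇ≡true⇒≤ {x} {k} e = ≤ᵇ⇒≤ x k (≡true⇒T e)
  ≤ᵇ≡false⇒> : ∀ {x k} → (x ≤ᵇ k) ≡ false → k < x
  ≤ᵇ≡false⇒> {x} {k} e = ≰⇒> (λ p → subst T e (≤⇒≤ᵇ p))
  ≤⇒≤ᵇ≡true : ∀ {x k} → x ≤ k → (x ≤ᵇ k) ≡ true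
  ≤⇒≤ᵇ≡true p = T⇒≡true (≤⇒≤ᵇ p)
  >⇒≤ᵇ≡false : ∀ {x k} → k < x → (x ≤ᵇ k) ≡ false
  >⇒≤ᵇ≡false {x} {k} p with x ≤ᵇ k in e
  ... | true = ⊥-elim (<⇒≱ p (≤ᵇ≡true⇒≤ e))
  ... | false = refl

  below≡filter : ∀ k xs → below k xs ≡ filter (λ x → x ≤? k) xs
  below≡filter k [] = refl
  below≡filter k (x ∷ xs) with x ≤ᵇ k
  ... | true = cong (x ∷_) (below≡filter k xs)
  ... | false = below≡filter k xs

  above≡filter : ∀ k xs → above k xs ≡ filter (λ x → k <? x) xs
  above≡filter k [] = refl
  above≡filter k (x ∷ xs) with x ≤ᵇ k in e | k <ᵇ x in e'
  ... | true | true = ⊥-elim (<⇒≱ (<ᵇ⇒< k x (≡true⇒T e')) (≤ᵇ≡true⇒≤ {x} {k} e))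
  ... | true | false = above≡filter k xs
  ... | false | true = cong (x ∷_) (above≡filter k xs)
  ... | false | false = ⊥-elim (subst T e' (<⇒<ᵇ (≤ᵇ≡false⇒> {x} {k} e)))

  below-∷-≤ : ∀ k z w → z ≤ k → below k (z ∷ w) ≡ z ∷ below k w
  below-∷-≤ k z w p rewrite ≤⇒≤ᵇ≡true p = refl
  above-∷-≤ : ∀ k z w → z ≤ k → above k (z ∷ w) ≡ above k w
  above-∷-≤ k z w p rewrite ≤⇒≤ᵇ≡true p = refl
  below-∷-> : ∀ k z w → k < z → below k (z ∷ w) ≡ below k w
  below-∷-> k z w p rewrite >⇒≤ᵇ≡false p = refl
  above-∷-> : ∀ k z w → k < z → above k (z ∷ w) ≡ z ∷ above k w
  above-∷-> k z w p rewrite >⇒≤ᵇ≡false p = refl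

  below-all : ∀ k {xs} → All (_≤ k) xs → below k xs ≡ xs
  below-all k [] = refl
  below-all k {x ∷ xs} (p ∷ ps) rewrite below-∷-≤ k x xs p = cong (x ∷_) (below-all k ps)

  below-none : ∀ k {xs} → All (k <_) xs → below k xs ≡ []
  below-none k [] = refl
  below-none k {x ∷ xs} (p ∷ ps) rewrite below-∷-> k x xs p = below-none k ps

  above-all : ∀ k {xs} → All (k <_) xs → above k xs ≡ xs
  above-all k [] = refl
  above-all k {x ∷ xs} (p ∷ ps) rewrite above-∷-> k x xs p = cong (x ∷_) (above-all k ps)

  above-none : ∀ k {xs} → All (_≤ k) xs → above k xs ≡ []
  above-none k [] = refl
  above-none k {x ∷ xs} (p ∷ ps) rewrite above-∷-≤ k x xs p = above-none k ps

  below-++ : ∀ k xs ys → below k (xs ++ ys) ≡ below k xs ++ below k ys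
  below-++ k [] ys = refl
  below-++ k (x ∷ xs) ys with x ≤ᵇ k
  ... | true = cong (x ∷_) (below-++ k xs ys)
  ... | false = below-++ k xs ys

  above-++ : ∀ k xs ys → above k (xs ++ ys) ≡ above k xs ++ above k ys
  above-++ k [] ys = refl
  above-++ k (x ∷ xs) ys with x ≤ᵇ k
  ... | true = above-++ k xs ys
  ... | false = cong (x ∷_) (above-++ k xs ys)

  below-≤ : ∀ k xs → All (_≤ k) (below k xs)
  below-≤ k [] = []
  below-≤ k (x ∷ xs) with x ≤ᵇ k in e
  ... | true = ≤ᵇ≡true⇒≤ e ∷ below-≤ k xs
  ... | false = below-≤ k xs

  above-> : ∀ k xs → All (k <_) (above k xs)
  above-> k [] = []
  above-> k (x ∷ xs) with x ≤ᵇ k in e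
  ... | true = above-> k xs
  ... | false = ≤ᵇ≡false⇒> e ∷ above-> k xs

  sort-below : ∀ k xs → sort (below k xs) ≡ below k (sort xs)
  sort-below k xs rewrite below≡filter k xs | below≡filter k (sort xs) = sort-filter (λ x → x ≤? k) xs
  sort-above : ∀ k xs → sort (above k xs) ≡ above k (sort xs)
  sort-above k xs rewrite above≡filter k xs | above≡filter k (sort xs) = sort-filter (λ x → k <? x) xs

  sorted-split : ∀ k {xs} → Sorted xs → xs ≡ below k xs ++ above k xs
  sorted-split k sorted[] = refl
  sorted-split k {x ∷ xs} (sorted∷ a s) with x ≤? k
  ... | yes p rewrite below-∷-≤ k x xs p | above-∷-≤ k x xs p = cong (x ∷_) (sorted-split k s)
  ... | no np rewrite below-∷-> k x xs (≰⇒> np) | above-∷-> k x xs (≰⇒> np) =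
    sym (cong₂ (λ u v → u ++ x ∷ v) (below-none k (above-k a)) (above-all k (above-k a)))
    where
    above-k : ∀ {ys} → All (x ≤_) ys → All (k <_) ys
    above-k = All.map (<-≤-trans (≰⇒> np))

  below-[]⇒above : ∀ k w → below k w ≡ [] → above k w ≡ w
  below-[]⇒above k [] e = refl
  below-[]⇒above k (z ∷ w) e with z ≤ᵇ k
  below-[]⇒above k (z ∷ w) () | true
  ... | false = cong (z ∷_) (below-[]⇒above k w e)

  above-[]⇒below : ∀ k w → above k w ≡ [] → below k w ≡ w
  above-[]⇒below k [] e = refl
  above-[]⇒below k (z ∷ w) e with z ≤ᵇ k
  above-[]⇒below k (z ∷ w) () | false
  ... | true = cong (z ∷_) (above-[]⇒below k w e)

  ≟-sym : ∀ x z → does (x ≟ z) ≡ does (z ≟ x)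
  ≟-sym x z = bool-ext (λ e → dec-true (z ≟ x) (sym (does-sound (x ≟ z) e))) (λ e → dec-true (x ≟ z) (sym (does-sound (z ≟ x) e)))

  ≟-ne : ∀ {x z} → x ≢ z → does (x ≟ z) ≡ false
  ≟-ne {x} {z} ne = dec-false (x ≟ z) ne

  multiplicity-map∷-[] : ∀ x S → multiplicity [] (map (x ∷_) S) ≡ 0
  multiplicity-map∷-[] x S = trans (sumN-map _ (x ∷_) S) (sumN-0 _ S (λ v → cong [_] (==-ne (x ∷ v) [] (λ ()))))

  multiplicity-map∷-∷ : ∀ x S z w → multiplicity (z ∷ w) (map (x ∷_) S) ≡ [ does (x ≟ z) ] * multiplicity w S
  multiplicity-map∷-∷ x S z w = trans (sumN-map _ (x ∷_) S)
    (trans (sumN-ext (λ v → trans (cong [_] (==-∷ x z v w)) ([∧] (does (x ≟ z)) (v == w))) S)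
      (sym (sumN-*ˡ [ does (x ≟ z) ] _ S)))

  []==∷ : ∀ x u → ([] == (x ∷ u)) ≡ false
  []==∷ x u = ==-ne [] (x ∷ u) (λ ())

  ==-all-above : ∀ k {b} w → All (k <_) b → (b == w) ≡ ((below k w == []) ∧ (above k w == b))
  ==-all-above k {b} w pb = bool-ext into from
    where
    into : (b == w) ≡ true → ((below k w == []) ∧ (above k w == b)) ≡ true
    into e with ==-sound b w e
    ... | refl rewrite below-none k pb | above-all k pb = ==-refl b
    from : ((below k w == []) ∧ (above k w == b)) ≡ true → (b == w) ≡ true
    from e with ==-sound (below k w) [] (∧-true₁ _ _ e) | ==-sound (above k w) b (∧-true₂ (below k w == []) _ e)
    ... | e₁ | e₂ rewrite sym e₂ | below-[]⇒above k w e₁ = ==-refl w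

  ==-all-below : ∀ k {a} w → All (_≤ k) a → (a == w) ≡ ((below k w == a) ∧ (above k w == []))
  ==-all-below k {a} w pa = bool-ext into from
    where
    into : (a == w) ≡ true → ((below k w == a) ∧ (above k w == [])) ≡ true
    into e with ==-sound a w e
    ... | refl rewrite below-all k pa | above-none k pa = ∧-true (==-refl a) refl
    from : ((below k w == a) ∧ (above k w == [])) ≡ true → (a == w) ≡ true
    from e with ==-sound (below k w) a (∧-true₁ _ _ e) | ==-sound (above k w) [] (∧-true₂ (below k w == a) _ e)
    ... | e₁ | e₂ rewrite sym e₁ | above-[]⇒below k w e₂ = ==-refl w

  multiplicity-shuffle : ∀ k a b w → All (_≤ k) a → All (k <_) b → multiplicity w (shuffle a b) ≡ [ below k w == a ] * [ above k w == b ]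
  multiplicity-shuffle k [] v w pa pb =
    trans (+-identityʳ _) (trans (cong [_] (==-all-above k w pb)) ([∧] (below k w == []) (above k w == v)))
  multiplicity-shuffle k (x ∷ u) [] w pa pb =
    trans (+-identityʳ _) (trans (cong [_] (==-all-below k w pa)) ([∧] (below k w == (x ∷ u)) (above k w == [])))
  multiplicity-shuffle k (x ∷ u) (y ∷ v) w (px ∷ pa) (py ∷ pb) =
    trans (sumN-++ (λ t → [ t == w ]) (map (x ∷_) (shuffle u (y ∷ v))) (map (y ∷_) (shuffle (x ∷ u) v))) (by-first-letter w)
    where
    by-first-letter : ∀ w → multiplicity w (map (x ∷_) (shuffle u (y ∷ v))) + multiplicity w (map (y ∷_) (shuffle (x ∷ u) v))
                           ≡ [ below k w == (x ∷ u) ] * [ above k w == (y ∷ v) ]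
    by-first-letter [] rewrite multiplicity-map∷-[] x (shuffle u (y ∷ v)) | multiplicity-map∷-[] y (shuffle (x ∷ u) v) | []==∷ x u = refl
    by-first-letter (z ∷ w) rewrite multiplicity-map∷-∷ x (shuffle u (y ∷ v)) z w | multiplicity-map∷-∷ y (shuffle (x ∷ u) v) z w
      | multiplicity-shuffle k u (y ∷ v) w pa (py ∷ pb) | multiplicity-shuffle k (x ∷ u) v w (px ∷ pa) pb with z ≤? k
    ... | yes z≤k rewrite below-∷-≤ k z w z≤k | above-∷-≤ k z w z≤k | ≟-ne {y} {z} (λ e → <⇒≱ py (subst (_≤ k) (sym e) z≤k))
          | ==-∷ z x (below k w) u | [∧] (does (z ≟ x)) (below k w == u) | ≟-sym x z =
          trans (+-identityʳ _) (sym (*-assoc [ does (z ≟ x) ] _ _))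
    ... | no z≰k rewrite below-∷-> k z w (≰⇒> z≰k) | above-∷-> k z w (≰⇒> z≰k) | ≟-ne {x} {z} (λ e → z≰k (subst (_≤ k) e px))
          | ==-∷ z y (above k w) v | [∧] (does (z ≟ y)) (above k w == v) | ≟-sym y z =
          trans (sym (*-assoc [ does (z ≟ y) ] A B)) (trans (cong (_* B) (*-comm [ does (z ≟ y) ] A)) (*-assoc A [ does (z ≟ y) ] B))
      where A = [ below k w == (x ∷ u) ]
            B = [ above k w == v ]

  PFsOf-spec : ∀ σ → All (λ a → isPF a ≡ true × (sort a == σ) ≡ true) (PFsOf σ)
  PFsOf-spec σ = All.zip
    ( AllP.filter⁺ (λ a → (sort a == σ) ≟B true) (AllP.all-filter (λ a → isPF a ≟B true) (words (length σ) (length σ)))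
    , AllP.all-filter (λ a → (sort a == σ) ≟B true) (PFs (length σ)))

  All-≤-bound : ∀ {k xs} → All (λ x → 1 ≤ x × x ≤ k) xs → All (_≤ k) xs
  All-≤-bound = All.map proj₂

  shift-above : ∀ k {xs} {m} → All (λ x → 1 ≤ x × x ≤ m) xs → All (k <_) (shift k xs)
  shift-above k [] = []
  shift-above k {x ∷ xs} ((a , _) ∷ ps) = subst (k <_) (+-comm x k) (+-monoˡ-≤ k a) ∷ shift-above k ps

  sorted-++ : ∀ k {xs ys} → Sorted xs → Sorted ys → All (_≤ k) xs → All (k <_) ys → Sorted (xs ++ ys)
  sorted-++ k sorted[] t _ _ = t
  sorted-++ k (sorted∷ a s) t (p ∷ ps) q = sorted∷ (All-++' a (All.map (λ z → ≤-trans p (<⇒≤ z)) q)) (sorted-++ k s t ps q)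
    where
    All-++' : ∀ {P : ℕ → Set} {us vs} → All P us → All P vs → All P (us ++ vs)
    All-++' [] q = q
    All-++' (p ∷ ps) q = p ∷ All-++' ps q

  boundedFrom-++ : ∀ i xs ys → T (boundedFrom i xs) → T (boundedFrom (length xs + i) ys) → T (boundedFrom i (xs ++ ys))
  boundedFrom-++ i [] ys _ t = t
  boundedFrom-++ i (x ∷ xs) ys s t = T∧-intro (T∧₁ (1 ≤ᵇ x) _ s) (T∧-intro (T∧₁ (x ≤ᵇ i) _ (T∧₂ (1 ≤ᵇ x) _ s))
    (boundedFrom-++ (suc i) xs ys (T∧₂ (x ≤ᵇ i) _ (T∧₂ (1 ≤ᵇ x) _ s)) (subst (λ j → T (boundedFrom j ys)) (sym (+-suc (length xs) i)) t)))

  boundedFrom-shift : ∀ k i ys → T (boundedFrom i ys) → T (boundedFrom (k + i) (shift k ys))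
  boundedFrom-shift k i [] t = _
  boundedFrom-shift k i (y ∷ ys) t = T∧-intro (≤⇒≤ᵇ (≤-trans (≤ᵇ⇒≤ 1 y (T∧₁ (1 ≤ᵇ y) _ t)) (m≤n+m y k)))
    (T∧-intro (≤⇒≤ᵇ (+-monoʳ-≤ k (≤ᵇ⇒≤ y i (T∧₁ (y ≤ᵇ i) _ (T∧₂ (1 ≤ᵇ y) _ t)))))
        (subst (λ j → T (boundedFrom j (shift k ys))) (+-suc k i) (boundedFrom-shift k (suc i) ys (T∧₂ (y ≤ᵇ i) _ (T∧₂ (1 ≤ᵇ y) _ t)))))

  NDPF-letters : ∀ {π} → IsNDPF π → All (λ x → 1 ≤ x × x ≤ length π) π
  NDPF-letters {π} (pf , _) = isPF-letters π pf

  NDPF-• : ∀ π' π'' → IsNDPF π' → IsNDPF π'' → IsNDPF (π' • π'')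
  NDPF-• π' π'' h' h'' = pf , Sorted⇒nondecreasing _ srt
    where
    k = length π'
    srt : Sorted (π' • π'')
    srt = sorted-++ k (nondecreasing⇒Sorted π' (proj₂ h')) (sorted-map (k +_) (+-monoʳ-≤ k) (nondecreasing⇒Sorted π'' (proj₂ h'')))
            (All-≤-bound (NDPF-letters {π'} h')) (shift-above k (NDPF-letters {π''} h''))
    bf : T (boundedFrom 1 (π' • π''))
    bf = boundedFrom-++ 1 π' (shift k π'')
           (subst (λ z → T (boundedFrom 1 z)) (IsNDPF-sort {π'} h') (proj₁ h'))
           (boundedFrom-shift k 1 π'' (subst (λ z → T (boundedFrom 1 z)) (IsNDPF-sort {π''} h'') (proj₁ h'')))
    pf : T (isPF (π' • π''))
    pf = subst (λ z → T (boundedFrom 1 z)) (sym (sort-of-sorted srt)) bf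

  unshift : ℕ → Word → Word
  unshift k = map (_∸ k)

  unshift-shift : ∀ k a → unshift k (shift k a) ≡ a
  unshift-shift k [] = refl
  unshift-shift k (x ∷ a) = cong₂ _∷_ (m+n∸m≡n k x) (unshift-shift k a)

  shift-unshift : ∀ k {h} → All (k <_) h → shift k (unshift k h) ≡ h
  shift-unshift k [] = refl
  shift-unshift k (p ∷ ps) = cong₂ _∷_ (m+[n∸m]≡n (<⇒≤ p)) (shift-unshift k ps)

  ==-shift : ∀ k h a → All (k <_) h → (h == shift k a) ≡ (a == unshift k h)
  ==-shift k h a p = bool-ext into from
    where
    into : (h == shift k a) ≡ true → (a == unshift k h) ≡ true
    into e rewrite ==-sound h (shift k a) e | unshift-shift k a = ==-refl a
    from : (a == unshift k h) ≡ true → (h == shift k a) ≡ true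
    from e rewrite ==-sound a (unshift k h) e | shift-unshift k p = ==-refl h

  shift-inj : ∀ k {a b} → shift k a ≡ shift k b → a ≡ b
  shift-inj k {a} {b} e = trans (sym (unshift-shift k a)) (trans (cong (unshift k) e) (unshift-shift k b))

  sort-below-above : ∀ k w → sort w ≡ sort (below k w) ++ shift k (sort (unshift k (above k w)))
  sort-below-above k w =
    begin
      sort w
    ≡⟨ sorted-split k (sort-sorted w) ⟩
      below k (sort w) ++ above k (sort w)
    ≡⟨ cong₂ _++_ (sym (sort-below k w)) (sym (sort-above k w)) ⟩
      sort (below k w) ++ sort (above k w)
    ≡⟨ cong (λ z → sort (below k w) ++ sort z) (sym (shift-unshift k (above-> k w))) ⟩
      sort (below k w) ++ sort (shift k (unshift k (above k w)))
    ≡⟨ cong (sort (below k w) ++_) (sort-map (k +_) (+-monoʳ-≤ k) (unshift k (above k w))) ⟩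
      sort (below k w) ++ shift k (sort (unshift k (above k w)))
    ∎
    where open ≡-Reasoning

  length-sort== : ∀ {a σ} → (sort a == σ) ≡ true → length a ≡ length σ
  length-sort== {a} {σ} e = trans (sym (sort-length a)) (cong length (==-sound (sort a) σ e))

  below-above-++ : ∀ k {xs ys} → All (_≤ k) xs → All (k <_) ys → below k (xs ++ ys) ≡ xs × above k (xs ++ ys) ≡ ys
  below-above-++ k {xs} {ys} xs≤ k<ys =
      trans (below-++ k xs ys) (trans (cong₂ _++_ (below-all k xs≤) (below-none k k<ys)) (++-identityʳ xs))
    , trans (above-++ k xs ys) (cong₂ _++_ (above-none k xs≤) (above-all k k<ys))

  sort-unshift-above : ∀ k w → All (k <_) (shift k (sort (unshift k (above k w))))
  sort-unshift-above k w = subst (All (k <_)) (sort-map (k +_) (+-monoʳ-≤ k) (unshift k (above k w)))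
    (All-resp-↭ (↭-sym (sort-↭ _)) (subst (All (k <_)) (sym (shift-unshift k (above-> k w))) (above-> k w)))

  -- sort w splits at k = |π'| into the sorted letters ≤ k and the sorted (shifted) letters > k
  sort==• : ∀ π' π'' → IsNDPF π' → IsNDPF π'' → ∀ w →
    ((sort (below (length π') w) == π') ∧ (sort (unshift (length π') (above (length π') w)) == π''))
    ≡ (sort w == (π' • π''))
  sort==• π' π'' h' h'' w = bool-ext fwd bwd
    where
    k = length π'
    L = sort (below k w)
    U = sort (unshift k (above k w))
    fwd : ((L == π') ∧ (U == π'')) ≡ true → (sort w == (π' • π'')) ≡ true
    fwd e = subst (λ z → (z == (π' • π'')) ≡ true)
      (sym (trans (sort-below-above k w) (cong₂ (λ a b → a ++ shift k b) (==-sound L π' (∧-true₁ _ _ e)) (==-sound U π'' (∧-true₂ (L == π') _ e)))))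
      (==-refl (π' • π''))
    bwd : (sort w == (π' • π'')) ≡ true → ((L == π') ∧ (U == π'')) ≡ true
    bwd e = ∧-true (subst (λ z → (z == π') ≡ true) (sym L≡π') (==-refl π'))
                   (subst (λ z → (z == π'') ≡ true) (sym (shift-inj k sU≡sπ'')) (==-refl π''))
      where
      w≡ : L ++ shift k U ≡ π' ++ shift k π''
      w≡ = trans (sym (sort-below-above k w)) (==-sound (sort w) (π' • π'') e)
      L≤ : All (_≤ k) L
      L≤ = All-resp-↭ (↭-sym (sort-↭ (below k w))) (below-≤ k w)
      splitw = below-above-++ k L≤ (sort-unshift-above k w)
      splitπ = below-above-++ k (All-≤-bound (NDPF-letters h')) (shift-above k (NDPF-letters h''))
      L≡π' : L ≡ π'
      L≡π' = trans (sym (proj₁ splitw)) (trans (cong (below k) w≡) (proj₁ splitπ))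
      sU≡sπ'' : shift k U ≡ shift k π''
      sU≡sπ'' = trans (sym (proj₂ splitw)) (trans (cong (above k) w≡) (proj₂ splitπ))

  -- a shuffle of a' with a''[k] is recovered from its letters ≤ k and > k
  multiplicity-product : ∀ π' π'' → IsNDPF π' → IsNDPF π'' → ∀ w →
    sumN (λ a' → sumN (λ a'' → multiplicity w (a' ⋒ a'')) (PFsOf π'')) (PFsOf π') ≡ [ sort w == (π' • π'') ]
  multiplicity-product π' π'' h' h'' w =
    begin
      sumN (λ a' → sumN (λ a'' → multiplicity w (a' ⋒ a'')) (PFsOf π'')) (PFsOf π')
    ≡⟨ sumN-All (All.map (λ {a'} pa' → sumN-All (All.map (λ {a''} pa'' → shuffle-term a' a'' pa' pa'') (PFsOf-spec π''))) (PFsOf-spec π')) ⟩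
      sumN (λ a' → sumN (λ a'' → [ a' == L ] * [ a'' == U ]) (PFsOf π'')) (PFsOf π')
    ≡⟨ sumN-ext (λ a' → sym (sumN-*ˡ [ a' == L ] _ (PFsOf π''))) (PFsOf π') ⟩
      sumN (λ a' → [ a' == L ] * multiplicity U (PFsOf π'')) (PFsOf π')
    ≡⟨ sym (sumN-*ʳ _ _ (PFsOf π')) ⟩
      multiplicity L (PFsOf π') * multiplicity U (PFsOf π'')
    ≡⟨ cong₂ _*_ (multiplicity-PFsOf-NDPF π' h' L) (multiplicity-PFsOf-NDPF π'' h'' U) ⟩
      [ sort L == π' ] * [ sort U == π'' ]
    ≡⟨ sym ([∧] (sort L == π') _) ⟩
      [ (sort L == π') ∧ (sort U == π'') ]
    ≡⟨ cong [_] (sort==• π' π'' h' h'' w) ⟩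
      [ sort w == (π' • π'') ]
    ∎
    where
    open ≡-Reasoning
    k = length π'
    L = below k w
    U = unshift k (above k w)
    shuffle-term : ∀ a' a'' → isPF a' ≡ true × (sort a' == π') ≡ true → isPF a'' ≡ true × (sort a'' == π'') ≡ true →
                   multiplicity w (a' ⋒ a'') ≡ [ a' == L ] * [ a'' == U ]
    shuffle-term a' a'' (p' , s') (p'' , _) rewrite length-sort== {a'} {π'} s' =
      trans (multiplicity-shuffle k a' (shift k a'') w
               (All-≤-bound (subst (λ m → All (λ x → 1 ≤ x × x ≤ m) a') (length-sort== {a'} {π'} s') (isPF-letters a' (≡true⇒T p'))))
               (shift-above k (isPF-letters a'' (≡true⇒T p''))))
            (cong₂ _*_ (cong [_] (==-sym L a')) (cong [_] (==-shift k (above k w) a'' (above-> k w))))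

  -- Parkization as a relabelling of letters

  parkStep : ℕ → ℕ → ℕ
  parkStep t x = if t <ᵇ x then x ∸ 1 else x

  parkMapFuel : ℕ → Word → ℕ → ℕ
  parkMapFuel zero w = id
  parkMapFuel (suc f) w with d w ≟ suc (length w)
  ... | yes _ = id
  ... | no _ = parkMapFuel f (decAbove (d w) w) ∘ parkStep (d w)

  parkFuel≡map : ∀ f w → parkFuel f w ≡ map (parkMapFuel f w) w
  parkFuel≡map zero w = sym (map-id w)
  parkFuel≡map (suc f) w with d w ≟ suc (length w)
  ... | yes _ = sym (map-id w)
  ... | no _ = trans (parkFuel≡map f (decAbove (d w) w)) (sym (map-∘ w))

  count≤-∷-≤ : ∀ i x w → x ≤ i → count≤ i (x ∷ w) ≡ suc (count≤ i w)
  count≤-∷-≤ i x w p rewrite ≤⇒≤ᵇ≡true p = refl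

  count≤-∷-> : ∀ i x w → i < x → count≤ i (x ∷ w) ≡ count≤ i w
  count≤-∷-> i x w p rewrite >⇒≤ᵇ≡false p = refl

  count≤-∷ : ∀ i x w → count≤ i (x ∷ w) ≤ suc (count≤ i w)
  count≤-∷ i x w with x ≤? i
  ... | yes p rewrite count≤-∷-≤ i x w p = ≤-refl
  ... | no p rewrite count≤-∷-> i x w (≰⇒> p) = n≤1+n _

  count≤-none : ∀ i w → All (i <_) w → count≤ i w ≡ 0
  count≤-none i [] _ = refl
  count≤-none i (x ∷ w) (p ∷ ps) rewrite count≤-∷-> i x w p = count≤-none i w ps

  count≤-suc : ∀ j w → count≤ j w ≤ count≤ (suc j) w
  count≤-suc j [] = z≤n
  count≤-suc j (x ∷ w) with x ≤? j
  ... | yes p rewrite count≤-∷-≤ j x w p | count≤-∷-≤ (suc j) x w (m≤n⇒m≤1+n p) = s≤s (count≤-suc j w)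
  ... | no p rewrite count≤-∷-> j x w (≰⇒> p) with x ≤? suc j
  ...   | yes q rewrite count≤-∷-≤ (suc j) x w q = m≤n⇒m≤1+n (count≤-suc j w)
  ...   | no q rewrite count≤-∷-> (suc j) x w (≰⇒> q) = count≤-suc j w

  count≤-hit : ∀ j w → suc j ∈ w → suc (count≤ j w) ≤ count≤ (suc j) w
  count≤-hit j (x ∷ w) (here refl) rewrite count≤-∷-> j (suc j) w ≤-refl | count≤-∷-≤ (suc j) (suc j) w ≤-refl = s≤s (count≤-suc j w)
  count≤-hit j (x ∷ w) (there m) with x ≤? j
  ... | yes p rewrite count≤-∷-≤ j x w p | count≤-∷-≤ (suc j) x w (m≤n⇒m≤1+n p) = s≤s (count≤-hit j w m)
  ... | no p rewrite count≤-∷-> j x w (≰⇒> p) with x ≤? suc j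
  ...   | yes q rewrite count≤-∷-≤ (suc j) x w q = m≤n⇒m≤1+n (count≤-hit j w m)
  ...   | no q rewrite count≤-∷-> (suc j) x w (≰⇒> q) = count≤-hit j w m

  count≤-all : ∀ i w → All (_≤ i) w → count≤ i w ≡ length w
  count≤-all i [] _ = refl
  count≤-all i (x ∷ w) (p ∷ ps) rewrite count≤-∷-≤ i x w p = cong suc (count≤-all i w ps)

  dsearch-below : ∀ i k w → (∀ j → j < i → j ≤ count≤ j w) → ∀ j → j < dsearch i k w → j ≤ count≤ j w
  dsearch-below i zero w h = h
  dsearch-below i (suc k) w h with count≤ i w <ᵇ i in e
  ... | true = h
  ... | false = dsearch-below (suc i) k w h'
    where
    h' : ∀ j → j < suc i → j ≤ count≤ j w
    h' j j<si with j <? i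
    ... | yes j<i = h j j<i
    ... | no j≮i rewrite ≤-antisym (s≤s⁻¹ j<si) (≮⇒≥ j≮i) = ≮⇒≥ (λ c → subst T e (<⇒<ᵇ c))

  dsearch-result : ∀ i k w → dsearch i k w ≡ i + k ⊎ count≤ (dsearch i k w) w < dsearch i k w
  dsearch-result i zero w = inj₁ (sym (+-identityʳ i))
  dsearch-result i (suc k) w with count≤ i w <ᵇ i in e
  ... | true = inj₂ (<ᵇ⇒< _ _ (subst T (sym e) _))
  ... | false with dsearch-result (suc i) k w
  ...   | inj₁ q = inj₁ (trans q (sym (+-suc i k)))
  ...   | inj₂ q = inj₂ q

  dsearch-≥ : ∀ i k w → i ≤ dsearch i k w
  dsearch-≥ i zero w = ≤-refl
  dsearch-≥ i (suc k) w with count≤ i w <ᵇ i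
  ... | true = ≤-refl
  ... | false = ≤-trans (n≤1+n i) (dsearch-≥ (suc i) k w)

  dsearch-≤ : ∀ i k w → dsearch i k w ≤ i + k
  dsearch-≤ i zero w = ≤-reflexive (sym (+-identityʳ i))
  dsearch-≤ i (suc k) w with count≤ i w <ᵇ i
  ... | true = m≤m+n i (suc k)
  ... | false = ≤-trans (dsearch-≤ (suc i) k w) (≤-reflexive (sym (+-suc i k)))

  d-below : ∀ w j → j < d w → j ≤ count≤ j w
  d-below w = dsearch-below 1 (length w) w (λ { zero _ → z≤n ; (suc j) (s≤s ()) })

  d-positive : ∀ w → 1 ≤ d w
  d-positive w = dsearch-≥ 1 (length w) w

  d∉ : ∀ w → d w ≢ suc (length w) → ¬ (d w ∈ w)
  d∉ w ne m with dsearch-result 1 (length w) w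
  ... | inj₁ q = ne q
  ... | inj₂ q with d w | d-positive w | d-below w
  ...   | suc j | _ | below-d = <⇒≱ q (≤-trans (s≤s (below-d j ≤-refl)) (count≤-hit j w m))

  all-or-any : ∀ t w → All (_≤ t) w ⊎ Any (t <_) w
  all-or-any t [] = inj₁ []
  all-or-any t (x ∷ w) with x ≤? t | all-or-any t w
  ... | yes p | inj₁ a = inj₁ (p ∷ a)
  ... | yes p | inj₂ a = inj₂ (there a)
  ... | no p | _ = inj₂ (here (≰⇒> p))

  d-exceeded : ∀ w → d w ≢ suc (length w) → Any (d w <_) w
  d-exceeded w ne with all-or-any (d w) w
  ... | inj₂ a = a
  ... | inj₁ a with dsearch-result 1 (length w) w
  ...   | inj₁ q = ⊥-elim (ne q)
  ...   | inj₂ q rewrite count≤-all (d w) w a = ⊥-elim (ne (≤-antisym (dsearch-≤ 1 (length w) w) q))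

  parkStep-≤ : ∀ t x → parkStep t x ≤ x
  parkStep-≤ t x with t <ᵇ x
  ... | true = m∸n≤m x 1
  ... | false = ≤-refl

  parkStep-< : ∀ t x → t < x → suc (parkStep t x) ≤ x
  parkStep-< t x p with t <ᵇ x in e
  ... | true = ≤-reflexive (trans (sym (+-comm (x ∸ 1) 1)) (m∸n+n≡m (≤-trans (s≤s z≤n) p)))
  ... | false = ⊥-elim (subst T e (<⇒<ᵇ p))

  parkStep-mono : ∀ t → Monotone (parkStep t)
  parkStep-mono t {x} {y} p with t <ᵇ x in e1 | t <ᵇ y in e2
  ... | true | true = ∸-monoˡ-≤ 1 p
  ... | true | false = ⊥-elim (subst T e2 (<⇒<ᵇ (<-≤-trans (<ᵇ⇒< t x (subst T (sym e1) _)) p)))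
  ... | false | true = ≤-trans (≮⇒≥ (λ c → subst T e1 (<⇒<ᵇ c))) (≤-pred' (<ᵇ⇒< t y (subst T (sym e2) _)))
    where
    ≤-pred' : ∀ {a b} → a < b → a ≤ b ∸ 1
    ≤-pred' {a} {suc b} (s≤s q) = q
  ... | false | false = p

  parkStep-positive : ∀ t x → 1 ≤ t → 1 ≤ x → 1 ≤ parkStep t x
  parkStep-positive t x t1 x1 with t <ᵇ x in e
  ... | true = ≤-pred'' (<-≤-trans (s≤s t1) (<ᵇ⇒< t x (subst T (sym e) _)))
    where
    ≤-pred'' : ∀ {b} → 2 ≤ b → 1 ≤ b ∸ 1
    ≤-pred'' {suc (suc b)} _ = s≤s z≤n
    ≤-pred'' {suc zero} (s≤s ())
  ... | false = x1

  parkStep-strict : ∀ t x y → x ≢ t → y ≢ t → x < y → parkStep t x < parkStep t y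
  parkStep-strict t x y xt yt p with t <ᵇ x in e1 | t <ᵇ y in e2
  ... | true | true = lemma (<ᵇ⇒< t x (subst T (sym e1) _)) p
    where
    lemma : ∀ {a b} → t < a → a < b → a ∸ 1 < b ∸ 1
    lemma {suc a} {suc b} _ (s≤s q) = q
  ... | true | false = ⊥-elim (subst T e2 (<⇒<ᵇ (<-trans (<ᵇ⇒< t x (subst T (sym e1) _)) p)))
  ... | false | true = lemma (≤∧≢⇒< (≮⇒≥ (λ c → subst T e1 (<⇒<ᵇ c))) xt) (<ᵇ⇒< t y (subst T (sym e2) _))
    where
    lemma : ∀ {a b} → a < t → t < b → a < b ∸ 1
    lemma {a} {suc b} q (s≤s r) = <-≤-trans q r
  ... | false | false = p

  sum-parkStep-≤ : ∀ t w → sum (map (parkStep t) w) ≤ sum w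
  sum-parkStep-≤ t [] = z≤n
  sum-parkStep-≤ t (x ∷ w) = +-mono-≤ (parkStep-≤ t x) (sum-parkStep-≤ t w)

  sum-parkStep-< : ∀ t w → Any (t <_) w → sum (map (parkStep t) w) < sum w
  sum-parkStep-< t (x ∷ w) (here p) = +-mono-≤ (parkStep-< t x p) (sum-parkStep-≤ t w)
  sum-parkStep-< t (x ∷ w) (there a) = ≤-trans (≤-reflexive (sym (+-suc (parkStep t x) _))) (+-mono-≤ (parkStep-≤ t x) (sum-parkStep-< t w a))

  parkStep-All-positive : ∀ t → 1 ≤ t → ∀ {w} → All (1 ≤_) w → All (1 ≤_) (map (parkStep t) w)
  parkStep-All-positive t t1 [] = []
  parkStep-All-positive t t1 (p ∷ ps) = parkStep-positive t _ t1 p ∷ parkStep-All-positive t t1 ps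

  length≤sum : ∀ {w} → All (1 ≤_) w → length w ≤ sum w
  length≤sum [] = z≤n
  length≤sum (p ∷ ps) = +-mono-≤ p (length≤sum ps)

  count≤-↭ : ∀ i {w w'} → w ↭ w' → count≤ i w ≡ count≤ i w'
  count≤-↭ i p = ↭-length (filter-↭ (λ x → x ≤? i) p)

  boundedFrom-of-count≤ : ∀ p xs → Sorted xs → All (1 ≤_) xs →
    (∀ j → suc p ≤ j → j ≤ p + length xs → j ≤ p + count≤ j xs) → T (boundedFrom (suc p) xs)
  boundedFrom-of-count≤ p [] _ _ _ = _
  boundedFrom-of-count≤ p (x ∷ xs) (sorted∷ a s) (q ∷ qs) h = T∧-intro (≤⇒≤ᵇ q) (T∧-intro (≤⇒≤ᵇ x≤) (boundedFrom-of-count≤ (suc p) xs s qs h'))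
    where
    x≤ : x ≤ suc p
    x≤ with x ≤? suc p
    ... | yes r = r
    ... | no r = ⊥-elim (1+n≰n (subst (suc p ≤_) (trans (cong (p +_) c0) (+-identityʳ p)) v))
      where
      gt : All (suc p <_) (x ∷ xs)
      gt = ≰⇒> r ∷ All-gen' a
        where
        All-gen' : ∀ {ys} → All (x ≤_) ys → All (suc p <_) ys
        All-gen' [] = []
        All-gen' (b ∷ bs) = <-≤-trans (≰⇒> r) b ∷ All-gen' bs
      c0 : count≤ (suc p) (x ∷ xs) ≡ 0
      c0 = count≤-none (suc p) (x ∷ xs) gt
      v : suc p ≤ p + count≤ (suc p) (x ∷ xs)
      v = h (suc p) ≤-refl (≤-trans (≤-reflexive (+-comm 1 p)) (+-monoʳ-≤ p (s≤s z≤n)))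
    h' : ∀ j → suc (suc p) ≤ j → j ≤ suc p + length xs → j ≤ suc p + count≤ j xs
    h' j l u = ≤-trans (h j (≤-trans (n≤1+n _) l) (≤-trans u (≤-reflexive (sym (+-suc p (length xs))))))
                 (≤-trans (+-monoʳ-≤ p (count≤-∷ j x xs)) (≤-reflexive (+-suc p _)))

  isPF-of-d : ∀ w → d w ≡ suc (length w) → All (1 ≤_) w → T (isPF w)
  isPF-of-d w e a = boundedFrom-of-count≤ 0 (sort w) (sort-sorted w) (All-resp-↭ (↭-sym (sort-↭ w)) a) h
    where
    h : ∀ j → 1 ≤ j → j ≤ length (sort w) → j ≤ count≤ j (sort w)
    h j _ u = subst (j ≤_) (count≤-↭ j (↭-sym (sort-↭ w))) (d-below w j (subst (j <_) (sym e) (s≤s (subst (j ≤_) (sort-length w) u))))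

  isPF-parkFuel : ∀ f w → All (1 ≤_) w → sum w < f + length w → T (isPF (parkFuel f w))
  isPF-parkFuel zero w a lt = ⊥-elim (<⇒≱ lt (length≤sum a))
  isPF-parkFuel (suc f) w a lt with d w ≟ suc (length w)
  ... | yes e = isPF-of-d w e a
  ... | no ne = isPF-parkFuel f (decAbove (d w) w) (parkStep-All-positive (d w) (d-positive w) a) lt'
    where
    lt' : sum (map (parkStep (d w)) w) < f + length (map (parkStep (d w)) w)
    lt' = subst (λ z → sum (map (parkStep (d w)) w) < f + z) (sym (length-map (parkStep (d w)) w))
            (s≤s⁻¹ (≤-trans (s≤s (sum-parkStep-< (d w) w (d-exceeded w ne))) lt))

  isPF-Park : ∀ w → All (1 ≤_) w → T (isPF (Park w))
  isPF-Park [] _ = _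
  isPF-Park (x ∷ w) a = isPF-parkFuel (sum (x ∷ w)) (x ∷ w) a (m<m+n (sum (x ∷ w)) (s≤s z≤n))

  dsearch-↭ : ∀ i k {w w'} → w ↭ w' → dsearch i k w ≡ dsearch i k w'
  dsearch-↭ i zero p = refl
  dsearch-↭ i (suc k) {w} {w'} p rewrite count≤-↭ i p with count≤ i w' <ᵇ i
  ... | true = refl
  ... | false = dsearch-↭ (suc i) k p

  d-↭ : ∀ {w w'} → w ↭ w' → d w ≡ d w'
  d-↭ {w} {w'} p = trans (cong (λ n → dsearch 1 n w) (↭-length p)) (dsearch-↭ 1 (length w') p)

  parkMapFuel-mono : ∀ f w → Monotone (parkMapFuel f w)
  parkMapFuel-mono zero w p = p
  parkMapFuel-mono (suc f) w p with d w ≟ suc (length w)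
  ... | yes _ = p
  ... | no _ = parkMapFuel-mono f (decAbove (d w) w) (parkStep-mono (d w) p)

  parkMapFuel-↭ : ∀ f {w w'} → w ↭ w' → ∀ x → parkMapFuel f w x ≡ parkMapFuel f w' x
  parkMapFuel-↭ zero p x = refl
  parkMapFuel-↭ (suc f) {w} {w'} p x with d w ≟ suc (length w) | d w' ≟ suc (length w')
  ... | yes _ | yes _ = refl
  ... | yes e | no ne = ⊥-elim (ne (trans (sym (d-↭ p)) (trans e (cong suc (↭-length p)))))
  ... | no ne | yes e = ⊥-elim (ne (trans (d-↭ p) (trans e (cong suc (sym (↭-length p))))))
  ... | no _ | no _ rewrite d-↭ p = parkMapFuel-↭ f (map⁺ (parkStep (d w')) p) (parkStep (d w') x)

  parkMapFuel-strict : ∀ f w {x y} → x ∈ w → y ∈ w → x < y → parkMapFuel f w x < parkMapFuel f w y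
  parkMapFuel-strict zero w _ _ p = p
  parkMapFuel-strict (suc f) w {x} {y} mx my p with d w ≟ suc (length w)
  ... | yes _ = p
  ... | no ne = parkMapFuel-strict f (decAbove (d w) w) (∈-map⁺ (parkStep (d w)) mx) (∈-map⁺ (parkStep (d w)) my)
                  (parkStep-strict (d w) x y (λ e → d∉ w ne (subst (_∈ w) e mx)) (λ e → d∉ w ne (subst (_∈ w) e my)) p)

  parkMap : Word → ℕ → ℕ
  parkMap u = parkMapFuel (sum u) u

  Park≡map-parkMap : ∀ {x u} → x ↭ u → Park x ≡ map (parkMap u) x
  Park≡map-parkMap {x} {u} p = trans (parkFuel≡map (sum x) x) (map-cong (λ z → trans (cong (λ s → parkMapFuel s x z) (sum-↭ p)) (parkMapFuel-↭ (sum u) p z)) x)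

  Park-self : ∀ u → Park u ≡ map (parkMap u) u
  Park-self u = parkFuel≡map (sum u) u

  parkMap-mono : ∀ u → Monotone (parkMap u)
  parkMap-mono u = parkMapFuel-mono (sum u) u

  parkMap-strict : ∀ u {x y} → x ∈ u → y ∈ u → x < y → parkMap u x < parkMap u y
  parkMap-strict u = parkMapFuel-strict (sum u) u

  parkMap-injective : ∀ u {x y} → x ∈ u → y ∈ u → parkMap u x ≡ parkMap u y → x ≡ y
  parkMap-injective u {x} {y} mx my e with <-cmp x y
  ... | tri< a _ _ = ⊥-elim (<-irrefl e (parkMap-strict u mx my a))
  ... | tri≈ _ b _ = b
  ... | tri> _ _ c = ⊥-elim (<-irrefl (sym e) (parkMap-strict u my mx c))

  preimage : (ℕ → ℕ) → Word → ℕ → ℕ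
  preimage G [] y = 0
  preimage G (p ∷ ps) y = if G p ≡ᵇ y then p else preimage G ps y

  preimage-spec : ∀ G u y → y ∈ map G u → preimage G u y ∈ u × G (preimage G u y) ≡ y
  preimage-spec G (p ∷ ps) y m with G p ≡ᵇ y in e
  ... | true = here refl , ≡ᵇ⇒≡ (G p) y (subst T (sym e) _)
  ... | false with m
  ...   | here q = ⊥-elim (subst T e (≡⇒≡ᵇ (G p) y (sym q)))
  ...   | there m' = there (proj₁ (preimage-spec G ps y m')) , proj₂ (preimage-spec G ps y m')

  ∈-self : ∀ (xs : Word) → All (_∈ xs) xs
  ∈-self [] = []
  ∈-self (x ∷ xs) = here refl ∷ All.map there (∈-self xs)

  ↭⇒⊆ : ∀ {x u : Word} → x ↭ u → All (_∈ u) x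
  ↭⇒⊆ {x} p = All.map (∈-resp-↭ p) (∈-self x)

  parkMap-injectiveOn : ∀ u {x x'} → All (_∈ u) x → All (_∈ u) x' → map (parkMap u) x ≡ map (parkMap u) x' → x ≡ x'
  parkMap-injectiveOn u [] [] e = refl
  parkMap-injectiveOn u [] (_ ∷ _) ()
  parkMap-injectiveOn u (_ ∷ _) [] ()
  parkMap-injectiveOn u (m ∷ ms) (m' ∷ ms') e = cong₂ _∷_ (parkMap-injective u m m' (∷-injectiveˡ e)) (parkMap-injectiveOn u ms ms' (∷-injectiveʳ e))

  sort-Park : ∀ {x u} → x ↭ u → Sorted u → sort (Park x) ≡ Park u
  sort-Park {x} {u} p s = begin
      sort (Park x)
    ≡⟨ cong sort (Park≡map-parkMap p) ⟩
      sort (map (parkMap u) x)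
    ≡⟨ sort-map (parkMap u) (parkMap-mono u) x ⟩
      map (parkMap u) (sort x)
    ≡⟨ cong (map (parkMap u)) (trans (sort-cong p) (sort-of-sorted s)) ⟩
      map (parkMap u) u
    ≡⟨ sym (Park-self u) ⟩
      Park u
    ∎
    where open ≡-Reasoning

  sort≡⇒↭ : ∀ {x u} → sort x ≡ u → x ↭ u
  sort≡⇒↭ {x} refl = ↭-sym (sort-↭ x)

  Park-injective-on-fibre : ∀ {u x y} → x ↭ u → y ↭ u → Park x ≡ Park y → x ≡ y
  Park-injective-on-fibre {u} {x} {y} x↭u y↭u e =
    parkMap-injectiveOn u (↭⇒⊆ x↭u) (↭⇒⊆ y↭u) (trans (sym (Park≡map-parkMap x↭u)) (trans e (Park≡map-parkMap y↭u)))

  Park-fibre-inhabited : ∀ {u a} → sort a ≡ Park u → Σ Word (λ x → x ↭ u × Park x ≡ a)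
  Park-fibre-inhabited {u} {a} sa = x₀ , x₀↭u , trans (Park≡map-parkMap x₀↭u) Gx₀
    where
    G = parkMap u
    H = preimage G u
    a↭ : a ↭ map G u
    a↭ = ↭-trans (↭-sym (sort-↭ a)) (subst (_↭ map G u) (sym (trans sa (Park-self u))) ↭-refl)
    x₀ = map H a
    Gx₀ : map G x₀ ≡ a
    Gx₀ = trans (sym (map-∘ a)) (map-id-local (All.map (λ m → proj₂ (preimage-spec G u _ m)) (↭⇒⊆ a↭)))
    HG : map H (map G u) ≡ u
    HG = trans (sym (map-∘ u)) (map-id-local (All.map (λ {p} m → let q = preimage-spec G u (G p) (∈-map⁺ G m) in
                                                     parkMap-injective u (proj₁ q) m (proj₂ q)) (∈-self u)))
    x₀↭u : x₀ ↭ u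
    x₀↭u = subst (x₀ ↭_) HG (map⁺ H a↭)

  -- Park is a bijection from the rearrangements of a nondecreasing u onto the rearrangements of Park u
  multiplicity-Park-fibre : ∀ k n u a → Sorted u → InWords k n u →
    sumN (λ x → [ sort x == u ] * [ Park x == a ]) (words k n) ≡ [ sort a == Park u ]
  multiplicity-Park-fibre k n u a su (lenu , rngu) with sort a == Park u in ea
  ... | false = sumN-0 _ (words k n) no-term
    where
    no-term : ∀ x → [ sort x == u ] * [ Park x == a ] ≡ 0
    no-term x with sort x == u in e1 | Park x == a in e2
    ... | false | _ = refl
    ... | true | false = refl
    ... | true | true with trans (sym ea) (subst (λ z → (z == Park u) ≡ true)
            (sym (trans (sym (cong sort (==-sound (Park x) a e2))) (sort-Park (sort≡⇒↭ {x} (==-sound (sort x) u e1)) su)))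
            (==-refl (Park u)))
    ... | ()
  ... | true = trans (sumN-ext term (words k n)) (multiplicity-words k n x₀ (trans (↭-length x₀↭u) lenu , All-resp-↭ (↭-sym x₀↭u) rngu))
    where
    fibre = Park-fibre-inhabited {u} {a} (==-sound (sort a) (Park u) ea)
    x₀ = proj₁ fibre
    x₀↭u = proj₁ (proj₂ fibre)
    Park-x₀ = proj₂ (proj₂ fibre)
    term : ∀ x → [ sort x == u ] * [ Park x == a ] ≡ [ x == x₀ ]
    term x = trans (sym ([∧] (sort x == u) _)) (cong [_] (bool-ext into from))
      where
      into : ((sort x == u) ∧ (Park x == a)) ≡ true → (x == x₀) ≡ true
      into e = subst (λ z → (x == z) ≡ true)
        (Park-injective-on-fibre (sort≡⇒↭ {x} (==-sound (sort x) u (∧-true₁ (sort x == u) _ e))) x₀↭u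
          (trans (==-sound (Park x) a (∧-true₂ (sort x == u) _ e)) (sym Park-x₀)))
        (==-refl x)
      from : (x == x₀) ≡ true → ((sort x == u) ∧ (Park x == a)) ≡ true
      from e rewrite ==-sound x x₀ e =
        ∧-true (subst (λ z → (z == u) ≡ true) (sym (trans (sort-cong x₀↭u) (sort-of-sorted su))) (==-refl u))
               (subst (λ z → (z == a) ≡ true) (sym Park-x₀) (==-refl a))

  All-concatMap : ∀ {a b p} {X : Set a} {Y : Set b} {P : Y → Set p} (f : X → List Y) xs → All (λ x → All P (f x)) xs → All P (concatMap f xs)
  All-concatMap f xs ps = AllP.concat⁺ (AllP.map⁺ ps)

  words-InWords : ∀ n m → All (InWords n m) (words n m)
  words-InWords zero m = (refl , []) ∷ []
  words-InWords (suc n) m = All-concatMap (λ x → map (x ∷_) (words n m)) (applyUpTo suc m)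
    (AllP.applyUpTo⁺₁ suc m (λ l → AllP.map⁺ (All.map (λ { (len , a) → cong suc len , (s≤s z≤n , l) ∷ a }) (words-InWords n m))))

  upTo-All : ∀ m → All (_< m) (upTo m)
  upTo-All m = AllP.applyUpTo⁺₁ id m id

  InWords-sort : ∀ {k n x} → InWords k n x → InWords k n (sort x)
  InWords-sort {k} {n} {x} (len , a) = trans (sort-length x) len , All-resp-↭ (↭-sym (sort-↭ x)) a

  sumN-sort-fibre : ∀ k n x → InWords k n x → ∀ Z → sumN (λ u → [ sort x == u ] * Z) (words k n) ≡ Z
  sumN-sort-fibre k n x h Z = trans (sumN-ext (λ u → cong (λ b → [ b ] * Z) (==-sym (sort x) u)) (words k n))
    (trans (sumN-indicator (sort x) (λ _ → Z) (words k n)) (trans (cong (_* Z) (multiplicity-words k n (sort x) (InWords-sort h))) (+-identityʳ Z)))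

  sumN-splits : ∀ (h : Word × Word → ℕ) w → sumN h (splits w) ≡ sumN (λ i → h (take i w , drop i w)) (upTo (suc (length w)))
  sumN-splits h [] = refl
  sumN-splits h (x ∷ w) = cong (h ([] , x ∷ w) +_)
    (trans (sumN-map h (λ p → (x ∷ proj₁ p , proj₂ p)) (splits w))
    (trans (sumN-splits (λ p → h (x ∷ proj₁ p , proj₂ p)) w)
    (trans (sym (sumN-map (λ i → h (take i (x ∷ w) , drop i (x ∷ w))) suc (upTo (suc (length w)))))
           (cong (sumN (λ i → h (take i (x ∷ w) , drop i (x ∷ w)))) (map-upTo suc (suc (length w)))))))

  sumN-words-+ : ∀ i j m (f : Word → ℕ) → sumN f (words (i + j) m) ≡ sumN (λ x → sumN (λ y → f (x ++ y)) (words j m)) (words i m)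
  sumN-words-+ zero j m f = sym (+-identityʳ _)
  sumN-words-+ (suc i) j m f =
    trans (sumN-concatMap f (λ c → map (c ∷_) (words (i + j) m)) (applyUpTo suc m))
    (trans (sumN-ext (λ c → trans (sumN-map f (c ∷_) (words (i + j) m)) (sumN-words-+ i j m (λ v → f (c ∷ v)))) (applyUpTo suc m))
    (sym (trans (sumN-concatMap (λ x → sumN (λ y → f (x ++ y)) (words j m)) (λ c → map (c ∷_) (words i m)) (applyUpTo suc m))
         (sumN-ext (λ c → sumN-map (λ x → sumN (λ y → f (x ++ y)) (words j m)) (c ∷_) (words i m)) (applyUpTo suc m)))))

  take-++ : ∀ {x y : Word} {i} → length x ≡ i → take i (x ++ y) ≡ x
  take-++ {[]} {y} refl = refl
  take-++ {a ∷ x} {y} refl = cong (a ∷_) (take-++ {x} {y} refl)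

  drop-++ : ∀ {x y : Word} {i} → length x ≡ i → drop i (x ++ y) ≡ y
  drop-++ {[]} refl = refl
  drop-++ {a ∷ x} {y} refl = drop-++ {x} {y} refl

  -- Coefficients of the coproduct, counted in ℕ

  parksTo : Word → Word → Word → Word → ℕ
  parksTo a b x y = [ Park x == a ] * [ Park y == b ]

  splitsParkingTo : Word → Word → Word → ℕ
  splitsParkingTo a b w = sumN (λ uv → parksTo a b (proj₁ uv) (proj₂ uv)) (splits w)

  -- the coefficient of F_a ⊗ F_b in Δ P^π, as a natural number
  ΔPCount : Word → Word → Word → ℕ
  ΔPCount π a b = sumN (splitsParkingTo a b) (PFsOf π)

  splitCountAt : Word → Word → Word → ℕ → ℕ
  splitCountAt π a b k = sumN (λ x → sumN (λ y → [ sort (x ++ y) == π ] * parksTo a b x y) (words (length π ∸ k) (length π))) (words k (length π))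

  splitCount : Word → Word → Word → ℕ
  splitCount π a b = sumN (splitCountAt π a b) (upTo (suc (length π)))

  sumN-split-position : ∀ π a b w → length w ≡ length π →
    [ sort w == π ] * splitsParkingTo a b w ≡ sumN (λ i → [ sort w == π ] * parksTo a b (take i w) (drop i w)) (upTo (suc (length π)))
  sumN-split-position π a b w len = trans (cong ([ sort w == π ] *_)
      (trans (sumN-splits _ w) (cong (λ m → sumN (λ i → parksTo a b (take i w) (drop i w)) (upTo (suc m))) len)))
    (sumN-*ˡ [ sort w == π ] (λ i → parksTo a b (take i w) (drop i w)) (upTo (suc (length π))))

  sumN-words-take-drop : ∀ π a b i → i ≤ length π →
    sumN (λ w → [ sort w == π ] * parksTo a b (take i w) (drop i w)) (words (length π) (length π)) ≡ splitCountAt π a b i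
  sumN-words-take-drop π a b i i≤n =
    trans (cong (λ m → sumN (λ w → [ sort w == π ] * parksTo a b (take i w) (drop i w)) (words m n)) (sym (m+[n∸m]≡n i≤n)))
      (trans (sumN-words-+ i (n ∸ i) n _)
        (sumN-All (All.map (λ {x} hx → sumN-ext (λ y → cong₂ (λ p q → [ sort (x ++ y) == π ] * parksTo a b p q)
           (take-++ {x} {y} (proj₁ hx)) (drop-++ {x} {y} (proj₁ hx))) (words (n ∸ i) n)) (words-InWords i n))))
    where n = length π

  ΔPCount≡splitCount : ∀ π a b → IsNDPF π → ΔPCount π a b ≡ splitCount π a b
  ΔPCount≡splitCount π a b hπ =
    begin
      ΔPCount π a b
    ≡⟨ sumN-PFsOf π hπ _ ⟩
      sumN (λ w → [ sort w == π ] * splitsParkingTo a b w) (words n n)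
    ≡⟨ sumN-All (All.map (λ {w} h → sumN-split-position π a b w (proj₁ h)) (words-InWords n n)) ⟩
      sumN (λ w → sumN (λ i → [ sort w == π ] * parksTo a b (take i w) (drop i w)) (upTo (suc n))) (words n n)
    ≡⟨ sumN-swap _ (words n n) (upTo (suc n)) ⟩
      sumN (λ i → sumN (λ w → [ sort w == π ] * parksTo a b (take i w) (drop i w)) (words n n)) (upTo (suc n))
    ≡⟨ sumN-All (All.map (λ {i} l → sumN-words-take-drop π a b i (s≤s⁻¹ l)) (upTo-All (suc n))) ⟩
      splitCount π a b
    ∎
    where
    open ≡-Reasoning
    n = length π

  PCoeffOfPark : Word → Word → ℕ
  PCoeffOfPark a u = multiplicity a (PFsOf (Park u))

  Park-IsNDPF : ∀ {u} → Sorted u → All (1 ≤_) u → IsNDPF (Park u)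
  Park-IsNDPF {u} s a = isPF-Park u a , subst (λ z → T (isNondecreasing z)) (sym (Park-self u)) (Sorted⇒nondecreasing _ (sorted-map (parkMap u) (parkMap-mono u) s))

  InWords-positive : ∀ {k n u} → InWords k n u → All (1 ≤_) u
  InWords-positive (_ , a) = All.map proj₁ a

  multiplicity-sort-fibre : ∀ k n u a → InWords k n u → sumN (λ x → [ sort x == u ] * [ Park x == a ]) (words k n) ≡ [ isNondecreasing u ] * PCoeffOfPark a u
  multiplicity-sort-fibre k n u a h with isNondecreasing u in e
  ... | true = trans (multiplicity-Park-fibre k n u a su h)
      (trans (sym (multiplicity-PFsOf-NDPF (Park u) (Park-IsNDPF su (InWords-positive h)) a)) (sym (+-identityʳ _)))
    where su = nondecreasing⇒Sorted u (≡true⇒T e)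
  ... | false = sumN-0 _ (words k n) no-term
    where
    no-term : ∀ x → [ sort x == u ] * [ Park x == a ] ≡ 0
    no-term x with sort x == u in e1
    ... | false = refl
    ... | true = ⊥-elim (subst T e (subst (λ q → T (isNondecreasing q)) (==-sound (sort x) u e1) (Sorted⇒nondecreasing _ (sort-sorted x))))

  sumN-if : ∀ {X : Set} (g : X → ℕ) c p → sumN g (if c then p ∷ [] else []) ≡ [ c ] * g p
  sumN-if g true p = refl
  sumN-if g false p = refl

  indicator-regroup : ∀ b₁ b₂ b₃ b₄ b₅ b₆ → (b₁ ≡ true → b₂ ≡ true → b₃ ≡ b₄) →
    [ b₁ ] * ([ b₂ ] * ([ b₃ ] * ([ b₅ ] * [ b₆ ]))) ≡ [ b₄ ] * (([ b₁ ] * [ b₅ ]) * ([ b₂ ] * [ b₆ ]))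
  indicator-regroup true true b₃ b₄ b₅ b₆ h with h refl refl
  ... | refl = both-true b₃ b₅ b₆
    where
    both-true : ∀ b₃ b₅ b₆ → [ true ] * ([ true ] * ([ b₃ ] * ([ b₅ ] * [ b₆ ]))) ≡ [ b₃ ] * (([ true ] * [ b₅ ]) * ([ true ] * [ b₆ ]))
    both-true true true true = refl
    both-true true true false = refl
    both-true true false b₆ = refl
    both-true false b₅ b₆ = refl
  indicator-regroup true false b₃ true true b₆ h = refl
  indicator-regroup true false b₃ true false b₆ h = refl
  indicator-regroup true false b₃ false b₅ b₆ h = refl
  indicator-regroup false b₂ b₃ true b₅ b₆ h = refl
  indicator-regroup false b₂ b₃ false b₅ b₆ h = refl

  indicator-collect : ∀ b₁ b₂ b₃ m n → [ b₃ ] * (([ b₁ ] * m) * ([ b₂ ] * n)) ≡ [ b₁ ∧ (b₂ ∧ b₃) ] * (m * n)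
  indicator-collect true true true m n rewrite *-identityˡ m | *-identityˡ n = refl
  indicator-collect true true false m n = refl
  indicator-collect true false true m n rewrite *-identityˡ m | *-zeroʳ m = refl
  indicator-collect true false false m n = refl
  indicator-collect false b₂ true m n = refl
  indicator-collect false b₂ false m n = refl

  sumN-sumN-factor : ∀ {X Y : Set} (s : ℕ) (f : X → ℕ) (g : Y → ℕ) xs ys →
    sumN (λ x → sumN (λ y → s * (f x * g y)) ys) xs ≡ s * (sumN f xs * sumN g ys)
  sumN-sumN-factor s f g xs ys =
    trans (sumN-ext (λ x → trans (sym (sumN-*ˡ s _ ys)) (cong (s *_) (sym (sumN-*ˡ (f x) g ys)))) xs)
    (trans (sym (sumN-*ˡ s _ xs)) (cong (s *_) (sym (sumN-*ʳ (sumN g ys) f xs))))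

  sumN-group-by-sort : ∀ k j n (G : Word → Word → ℕ) →
    sumN (λ x → sumN (G x) (words j n)) (words k n)
    ≡ sumN (λ u → sumN (λ v → sumN (λ x → sumN (λ y → [ sort x == u ] * ([ sort y == v ] * G x y)) (words j n)) (words k n)) (words j n)) (words k n)
  sumN-group-by-sort k j n G =
    begin
      sumN (λ x → sumN (λ y → G x y) Wj) Wk
    ≡⟨ sumN-All (All.map (λ {x} hx → sumN-All (All.map (λ {y} hy → insert-fibres x y hx hy) (words-InWords j n))) (words-InWords k n)) ⟩
      sumN (λ x → sumN (λ y → sumN (λ u → sumN (λ v → term x y u v) Wj) Wk) Wj) Wk
    ≡⟨ sumN-ext (λ x → sumN-swap (λ y u → sumN (λ v → term x y u v) Wj) Wj Wk) Wk ⟩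
      sumN (λ x → sumN (λ u → sumN (λ y → sumN (λ v → term x y u v) Wj) Wj) Wk) Wk
    ≡⟨ sumN-swap (λ x u → sumN (λ y → sumN (λ v → term x y u v) Wj) Wj) Wk Wk ⟩
      sumN (λ u → sumN (λ x → sumN (λ y → sumN (λ v → term x y u v) Wj) Wj) Wk) Wk
    ≡⟨ sumN-ext (λ u → sumN-ext (λ x → sumN-swap (λ y v → term x y u v) Wj Wj) Wk) Wk ⟩
      sumN (λ u → sumN (λ x → sumN (λ v → sumN (λ y → term x y u v) Wj) Wj) Wk) Wk
    ≡⟨ sumN-ext (λ u → sumN-swap (λ x v → sumN (λ y → term x y u v) Wj) Wk Wj) Wk ⟩
      sumN (λ u → sumN (λ v → sumN (λ x → sumN (λ y → term x y u v) Wj) Wk) Wj) Wk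
    ∎
    where
    open ≡-Reasoning
    Wk = words k n
    Wj = words j n
    term : Word → Word → Word → Word → ℕ
    term x y u v = [ sort x == u ] * ([ sort y == v ] * G x y)
    insert-fibres : ∀ x y → InWords k n x → InWords j n y → G x y ≡ sumN (λ u → sumN (λ v → term x y u v) Wj) Wk
    insert-fibres x y hx hy = sym (trans (sumN-ext (λ u → sym (sumN-*ˡ [ sort x == u ] (λ v → [ sort y == v ] * G x y) Wj)) Wk)
      (trans (sumN-ext (λ u → cong ([ sort x == u ] *_) (sumN-sort-fibre j n y hy (G x y))) Wk) (sumN-sort-fibre k n x hx (G x y))))

  ndPairsCountAt≡splitCountAt : ∀ π a b k j n →
    sumN (λ u → sumN (λ v → [ isNondecreasing u ∧ (isNondecreasing v ∧ (sort (u ++ v) == π)) ] * (PCoeffOfPark a u * PCoeffOfPark b v)) (words j n)) (words k n)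
    ≡ sumN (λ x → sumN (λ y → [ sort (x ++ y) == π ] * parksTo a b x y) (words j n)) (words k n)
  ndPairsCountAt≡splitCountAt π a b k j n = sym (
    begin
      sumN (λ x → sumN (λ y → [ sort (x ++ y) == π ] * parksTo a b x y) Wj) Wk
    ≡⟨ sumN-group-by-sort k j n (λ x y → [ sort (x ++ y) == π ] * parksTo a b x y) ⟩
      sumN (λ u → sumN (λ v → sumN (λ x → sumN (λ y → [ sort x == u ] * ([ sort y == v ] * ([ sort (x ++ y) == π ] * parksTo a b x y))) Wj) Wk) Wj) Wk
    ≡⟨ sumN-ext (λ u → sumN-ext (λ v → sumN-ext (λ x → sumN-ext (λ y → regroup x y u v) Wj) Wk) Wj) Wk ⟩
      sumN (λ u → sumN (λ v → sumN (λ x → sumN (λ y → [ sort (u ++ v) == π ] * (A u x * B v y)) Wj) Wk) Wj) Wk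
    ≡⟨ sumN-ext (λ u → sumN-ext (λ v → sumN-sumN-factor [ sort (u ++ v) == π ] (A u) (B v) Wk Wj) Wj) Wk ⟩
      sumN (λ u → sumN (λ v → [ sort (u ++ v) == π ] * (sumN (A u) Wk * sumN (B v) Wj)) Wj) Wk
    ≡⟨ sumN-All (All.map (λ {u} hu → sumN-All (All.map (λ {v} hv → cong₂ (λ p q → [ sort (u ++ v) == π ] * (p * q))
          (multiplicity-sort-fibre k n u a hu) (multiplicity-sort-fibre j n v b hv)) (words-InWords j n))) (words-InWords k n)) ⟩
      sumN (λ u → sumN (λ v → [ sort (u ++ v) == π ] * (([ isNondecreasing u ] * PCoeffOfPark a u) * ([ isNondecreasing v ] * PCoeffOfPark b v))) Wj) Wk
    ≡⟨ sumN-ext (λ u → sumN-ext (λ v → indicator-collect (isNondecreasing u) (isNondecreasing v) (sort (u ++ v) == π) (PCoeffOfPark a u) (PCoeffOfPark b v)) Wj) Wk ⟩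
      sumN (λ u → sumN (λ v → [ isNondecreasing u ∧ (isNondecreasing v ∧ (sort (u ++ v) == π)) ] * (PCoeffOfPark a u * PCoeffOfPark b v)) Wj) Wk
    ∎)
    where
    open ≡-Reasoning
    Wk = words k n
    Wj = words j n
    A : Word → Word → ℕ
    A u x = [ sort x == u ] * [ Park x == a ]
    B : Word → Word → ℕ
    B v y = [ sort y == v ] * [ Park y == b ]
    regroup : ∀ x y u v → [ sort x == u ] * ([ sort y == v ] * ([ sort (x ++ y) == π ] * parksTo a b x y)) ≡ [ sort (u ++ v) == π ] * (A u x * B v y)
    regroup x y u v = indicator-regroup (sort x == u) (sort y == v) (sort (x ++ y) == π) (sort (u ++ v) == π) (Park x == a) (Park y == b)
      (λ e₁ e₂ → cong (_== π) (sort-cong {x ++ y} {u ++ v} (++⁺ (sort≡⇒↭ {x} (==-sound (sort x) u e₁)) (sort≡⇒↭ {y} (==-sound (sort y) v e₂)))))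

  ndPairsCount : Word → Word → Word → ℕ
  ndPairsCount π a b = sumN (λ uv → PCoeffOfPark a (proj₁ uv) * PCoeffOfPark b (proj₂ uv)) (ndPairs π)

  ndPairsCount≡splitCount : ∀ π a b → ndPairsCount π a b ≡ splitCount π a b
  ndPairsCount≡splitCount π a b =
    trans (sumN-concatMap term pairsAt (upTo (suc n)))
    (sumN-ext (λ k → trans (sumN-concatMap term (pairsFrom k) (words k n))
       (trans (sumN-ext (λ u → trans (sumN-concatMap term (keepPair u) (words (n ∸ k) n))
           (sumN-ext (λ v → sumN-if term (isNondecreasing u ∧ isNondecreasing v ∧ (sort (u ++ v) == π)) (u , v)) (words (n ∸ k) n))) (words k n))
         (ndPairsCountAt≡splitCountAt π a b k (n ∸ k) n))) (upTo (suc n)))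
    where
    n = length π
    term : Word × Word → ℕ
    term uv = PCoeffOfPark a (proj₁ uv) * PCoeffOfPark b (proj₂ uv)
    keepPair : Word → Word → List (Word × Word)
    keepPair u v = if isNondecreasing u ∧ isNondecreasing v ∧ (sort (u ++ v) == π) then (u , v) ∷ [] else []
    pairsFrom : ℕ → Word → List (Word × Word)
    pairsFrom k u = concatMap (keepPair u) (words (n ∸ k) n)
    pairsAt : ℕ → List (Word × Word)
    pairsAt k = concatMap (pairsFrom k) (words k n)

  ΔPCount≡ndPairsCount : ∀ π a b → IsNDPF π → ΔPCount π a b ≡ ndPairsCount π a b
  ΔPCount≡ndPairsCount π a b h = trans (ΔPCount≡splitCount π a b h) (sym (ndPairsCount≡splitCount π a b))

  sumN-upTo-reverse : ∀ (f : ℕ → ℕ) n → sumN f (upTo (suc n)) ≡ sumN (λ k → f (n ∸ k)) (upTo (suc n))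
  sumN-upTo-reverse f zero = refl
  sumN-upTo-reverse f (suc n) =
    trans (sumN-upTo-suc f (suc n))
    (trans (+-comm _ (f (suc n)))
    (cong (f (suc n) +_) (trans (sumN-upTo-reverse f n)
       (trans (sym (sumN-map (λ k → f (suc n ∸ k)) suc (upTo (suc n)))) (cong (sumN (λ k → f (suc n ∸ k))) (map-upTo suc (suc n)))))))

  splitCountAt-sym : ∀ π a b k → k ≤ length π → splitCountAt π a b k ≡ splitCountAt π b a (length π ∸ k)
  splitCountAt-sym π a b k k≤n =
    trans (sumN-swap (λ x y → [ sort (x ++ y) == π ] * parksTo a b x y) (words k n) (words (n ∸ k) n))
    (trans (sumN-ext (λ y → sumN-ext (λ x → cong₂ _*_ (cong (λ z → [ z == π ]) (sort-++-comm x y)) (*-comm [ Park x == a ] _)) (words k n)) (words (n ∸ k) n))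
     (cong (λ j → sumN (λ y → sumN (λ x → [ sort (y ++ x) == π ] * parksTo b a y x) (words j n)) (words (n ∸ k) n)) (sym (m∸[m∸n]≡n k≤n))))
    where n = length π

  splitCount-sym : ∀ π a b → splitCount π a b ≡ splitCount π b a
  splitCount-sym π a b = trans (sumN-upTo-reverse (splitCountAt π a b) n)
    (sumN-All (All.map (λ {k} l → sym (splitCountAt-sym π b a k (s≤s⁻¹ l))) (upTo-All (suc n))))
    where n = length π

  ΔPCount-sym : ∀ π a b → IsNDPF π → ΔPCount π a b ≡ ΔPCount π b a
  ΔPCount-sym π a b h = trans (ΔPCount≡splitCount π a b h) (trans (splitCount-sym π a b) (sym (ΔPCount≡splitCount π b a h)))

module Coefficients {c ℓ} (Rg : CommutativeRing c ℓ) where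

  open import Data.Bool using (Bool; true; false; _∧_; _∨_; if_then_else_)
  open import Data.Bool.Properties using (∧-comm; ∨-zeroʳ)
  open import Data.List using (List; []; _∷_; _++_; map; length; concatMap; upTo)
  open import Data.List.Properties using (concatMap-++; map-++)
  open import Data.List.Relation.Unary.All using (All; []; _∷_)
  import Data.List.Relation.Unary.All as All
  import Data.List.Relation.Unary.All.Properties as AllP
  import Data.Nat as ℕ
  open import Data.Nat using (ℕ; zero; suc)
  open import Data.Product using (_×_; _,_; proj₁; proj₂)
  open import Data.Sum using (_⊎_; inj₁; inj₂)
  import Relation.Binary.PropositionalEquality as P
  open P using (_≡_)
  open import Relation.Nullary using (¬_)

  open Combinatorics

  open PQSym Rg
  open CommutativeRing Rg renaming (Carrier to K)
  open import Algebra.Properties.CommutativeSemigroup +-commutativeSemigroup using () renaming (interchange to +-interchange)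
  open import Algebra.Properties.CommutativeSemigroup *-commutativeSemigroup using () renaming (interchange to *-interchange)
  open import Relation.Binary.Reasoning.Setoid setoid

  sumR : ∀ {a} {X : Set a} → (X → K) → List X → K
  sumR f [] = 0#
  sumR f (x ∷ xs) = f x + sumR f xs

  sumR-cong : ∀ {a} {X : Set a} {f g : X → K} → (∀ x → f x ≈ g x) → ∀ xs → sumR f xs ≈ sumR g xs
  sumR-cong e [] = refl
  sumR-cong e (x ∷ xs) = +-cong (e x) (sumR-cong e xs)

  sumR-++ : ∀ {a} {X : Set a} (f : X → K) xs ys → sumR f (xs ++ ys) ≈ sumR f xs + sumR f ys
  sumR-++ f [] ys = sym (+-identityˡ _)
  sumR-++ f (x ∷ xs) ys = trans (+-cong refl (sumR-++ f xs ys)) (sym (+-assoc _ _ _))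

  sumR-map : ∀ {a b} {X : Set a} {Y : Set b} (f : Y → K) (g : X → Y) xs → sumR f (map g xs) ≡ sumR (λ x → f (g x)) xs
  sumR-map f g [] = P.refl
  sumR-map f g (x ∷ xs) = P.cong (f (g x) +_) (sumR-map f g xs)

  sumR-concatMap : ∀ {a b} {X : Set a} {Y : Set b} (f : Y → K) (g : X → List Y) xs →
    sumR f (concatMap g xs) ≈ sumR (λ x → sumR f (g x)) xs
  sumR-concatMap f g [] = refl
  sumR-concatMap f g (x ∷ xs) = trans (sumR-++ f (g x) (concatMap g xs)) (+-cong refl (sumR-concatMap f g xs))

  sumR-0 : ∀ {a} {X : Set a} (f : X → K) xs → (∀ x → f x ≈ 0#) → sumR f xs ≈ 0#
  sumR-0 f [] e = refl
  sumR-0 f (x ∷ xs) e = trans (+-cong (e x) (sumR-0 f xs e)) (+-identityˡ _)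

  sumR-+ : ∀ {a} {X : Set a} (f g : X → K) xs → sumR (λ x → f x + g x) xs ≈ sumR f xs + sumR g xs
  sumR-+ f g [] = sym (+-identityˡ _)
  sumR-+ f g (x ∷ xs) = trans (+-cong refl (sumR-+ f g xs)) (+-interchange (f x) (g x) (sumR f xs) (sumR g xs))

  sumR-*ˡ : ∀ {a} {X : Set a} k (f : X → K) xs → k * sumR f xs ≈ sumR (λ x → k * f x) xs
  sumR-*ˡ k f [] = zeroʳ k
  sumR-*ˡ k f (x ∷ xs) = trans (distribˡ k (f x) (sumR f xs)) (+-cong refl (sumR-*ˡ k f xs))

  sumR-swap : ∀ {a b} {X : Set a} {Y : Set b} (f : X → Y → K) xs ys →
    sumR (λ x → sumR (f x) ys) xs ≈ sumR (λ y → sumR (λ x → f x y) xs) ys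
  sumR-swap f [] ys = sym (sumR-0 (λ _ → 0#) ys (λ _ → refl))
  sumR-swap f (x ∷ xs) ys = trans (+-cong refl (sumR-swap f xs ys)) (sym (sumR-+ (f x) (λ y → sumR (λ x' → f x' y) xs) ys))

  ι : ℕ → K
  ι = natEmb Rg

  ι-+ : ∀ m n → ι (m ℕ.+ n) ≈ ι m + ι n
  ι-+ zero n = sym (+-identityˡ _)
  ι-+ (suc m) n = trans (+-cong refl (ι-+ m n)) (sym (+-assoc _ _ _))

  ι-* : ∀ m n → ι (m ℕ.* n) ≈ ι m * ι n
  ι-* zero n = sym (zeroˡ _)
  ι-* (suc m) n = begin
      ι (n ℕ.+ m ℕ.* n)       ≈⟨ ι-+ n (m ℕ.* n) ⟩
      ι n + ι (m ℕ.* n)       ≈⟨ +-cong (sym (*-identityˡ _)) (ι-* m n) ⟩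
      1# * ι n + ι m * ι n    ≈⟨ sym (distribʳ (ι n) 1# (ι m)) ⟩
      (1# + ι m) * ι n        ∎

  ι-1 : ι 1 ≈ 1#
  ι-1 = +-identityʳ 1#

  sumR-ι : ∀ {a} {X : Set a} (f : X → ℕ) xs → sumR (λ x → ι (f x)) xs ≈ ι (sumN f xs)
  sumR-ι f [] = refl
  sumR-ι f (x ∷ xs) = trans (+-cong refl (sumR-ι f xs)) (sym (ι-+ (f x) (sumN f xs)))

  coeff≡sumR : ∀ x w → coeff x w ≡ sumR (λ p → if proj₂ p == w then proj₁ p else 0#) x
  coeff≡sumR [] w = P.refl
  coeff≡sumR (p ∷ x) w = P.cong (_ +_) (coeff≡sumR x w)

  if-ι : ∀ (b : Bool) (k : K) → (if b then k else 0#) ≈ k * ι [ b ]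
  if-ι true k = sym (trans (*-cong refl ι-1) (*-identityʳ k))
  if-ι false k = sym (zeroʳ k)

  extend : (Word → K) → Lin → K
  extend h = sumR (λ p → proj₁ p * h (proj₂ p))

  δ : Word → Word → K
  δ w v = ι [ v == w ]

  coeff≈extend-δ : ∀ x w → coeff x w ≈ extend (δ w) x
  coeff≈extend-δ x w = P.subst (_≈ extend (δ w) x) (P.sym (coeff≡sumR x w)) (sumR-cong (λ p → if-ι (proj₂ p == w) (proj₁ p)) x)


  sumR-All : ∀ {a} {X : Set a} {f g : X → K} {xs} → All (λ x → f x ≈ g x) xs → sumR f xs ≈ sumR g xs
  sumR-All [] = refl
  sumR-All (e ∷ es) = +-cong e (sumR-All es)

  sumR-*ʳ : ∀ {a} {X : Set a} k (f : X → K) xs → sumR f xs * k ≈ sumR (λ x → f x * k) xs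
  sumR-*ʳ k f xs = trans (*-comm _ k) (trans (sumR-*ˡ k f xs) (sumR-cong (λ x → *-comm k (f x)) xs))

  removeWord : Word → List Word → List Word
  removeWord w [] = []
  removeWord w (v ∷ vs) = if v == w then removeWord w vs else v ∷ removeWord w vs

  dedup : List Word → List Word
  dedup [] = []
  dedup (v ∷ vs) = v ∷ removeWord v (dedup vs)

  member : Word → List Word → Bool
  member w [] = false
  member w (v ∷ vs) = (v == w) ∨ member w vs

  multiplicity-removeWord : ∀ u w vs → multiplicity w (removeWord u vs) ≡ (if u == w then 0 else multiplicity w vs)
  multiplicity-removeWord u w [] with u == w
  ... | true = P.refl
  ... | false = P.refl
  multiplicity-removeWord u w (v ∷ vs) with v == u in e
  ... | true rewrite multiplicity-removeWord u w vs | ==-sound v u e with u == w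
  ...   | true = P.refl
  ...   | false = P.refl
  multiplicity-removeWord u w (v ∷ vs) | false rewrite multiplicity-removeWord u w vs with u == w in e2
  ...   | false = P.refl
  ...   | true rewrite ==-sound u w e2 | e = P.refl

  multiplicity-dedup : ∀ w vs → multiplicity w (dedup vs) ≡ [ member w vs ]
  multiplicity-dedup w [] = P.refl
  multiplicity-dedup w (v ∷ vs) rewrite multiplicity-removeWord v w (dedup vs) | multiplicity-dedup w vs with v == w
  ... | true = P.refl
  ... | false = P.refl

  member-∷ : ∀ v w vs → member w vs ≡ true → member w (v ∷ vs) ≡ true
  member-∷ v w vs e = P.trans (P.cong ((v == w) ∨_) e) (∨-zeroʳ (v == w))

  member-++ˡ : ∀ w xs ys → member w xs ≡ true → member w (xs ++ ys) ≡ true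
  member-++ˡ w (v ∷ xs) ys e with v == w
  ... | true = P.refl
  ... | false = member-++ˡ w xs ys e

  member-++ʳ : ∀ w xs ys → member w ys ≡ true → member w (xs ++ ys) ≡ true
  member-++ʳ w [] ys e = e
  member-++ʳ w (v ∷ xs) ys e = member-∷ v w (xs ++ ys) (member-++ʳ w xs ys e)

  member-self : ∀ (x : Lin) → All (λ p → member (proj₂ p) (map proj₂ x) ≡ true) x
  member-self [] = []
  member-self (p ∷ x) =
    P.cong (_∨ member (proj₂ p) (map proj₂ x)) (==-refl (proj₂ p)) ∷ All.map (λ {q} → member-∷ (proj₂ p) (proj₂ q) (map proj₂ x)) (member-self x)

  sumR-indicator : ∀ (D : List Word) v (h : Word → K) → sumR (λ u → ι [ v == u ] * h u) D ≈ ι (multiplicity v D) * h v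
  sumR-indicator [] v h = sym (zeroˡ _)
  sumR-indicator (u ∷ D) v h with v == u in e
  ... | true rewrite ==-sound v u e | ==-refl u =
    trans (+-cong refl (sumR-indicator D u h))
      (trans (sym (distribʳ (h u) (ι 1) (ι (multiplicity u D)))) (*-cong (sym (ι-+ 1 (multiplicity u D))) refl))
  ... | false rewrite ==-sym u v | e = trans (+-cong (zeroˡ _) (sumR-indicator D v h)) (+-identityˡ _)

  extend-via-support : ∀ (x : Lin) (D : List Word) (h : Word → K) → All (λ p → multiplicity (proj₂ p) D ≡ 1) x →
    sumR (λ u → coeff x u * h u) D ≈ extend h x
  extend-via-support x D h once = begin
      sumR (λ u → coeff x u * h u) D
    ≈⟨ sumR-cong (λ u → *-cong (coeff≈extend-δ x u) refl) D ⟩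
      sumR (λ u → extend (δ u) x * h u) D
    ≈⟨ sumR-cong (λ u → sumR-*ʳ (h u) _ x) D ⟩
      sumR (λ u → sumR (λ p → (proj₁ p * δ u (proj₂ p)) * h u) x) D
    ≈⟨ sumR-swap (λ u p → (proj₁ p * δ u (proj₂ p)) * h u) D x ⟩
      sumR (λ p → sumR (λ u → (proj₁ p * δ u (proj₂ p)) * h u) D) x
    ≈⟨ sumR-cong (λ p → trans (sumR-cong (λ u → *-assoc _ _ _) D) (sym (sumR-*ˡ (proj₁ p) _ D))) x ⟩
      sumR (λ p → proj₁ p * sumR (λ u → δ u (proj₂ p) * h u) D) x
    ≈⟨ sumR-All (All.map (λ {p} e → *-cong refl (once-term p e)) once) ⟩
      extend h x
    ∎
    where
    once-term : ∀ p → multiplicity (proj₂ p) D ≡ 1 → sumR (λ u → δ u (proj₂ p) * h u) D ≈ h (proj₂ p)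
    once-term p e = trans (sumR-indicator D (proj₂ p) h)
      (P.subst (λ n → ι n * h (proj₂ p) ≈ h (proj₂ p)) (P.sym e) (trans (*-cong ι-1 refl) (*-identityˡ _)))

  support : Lin → Lin → List Word
  support x y = dedup (map proj₂ (x ++ y))

  support-once : ∀ x y {z : Lin} → (∀ w → member w (map proj₂ z) ≡ true → member w (map proj₂ (x ++ y)) ≡ true) →
    All (λ p → multiplicity (proj₂ p) (support x y) ≡ 1) z
  support-once x y z⊆ = All.map (λ {p} m → P.trans (multiplicity-dedup (proj₂ p) (map proj₂ (x ++ y))) (P.cong [_] (z⊆ (proj₂ p) m)))
    (member-self _)

  extend-cong-≋ : ∀ {x y} (h : Word → K) → x ≋ y → extend h x ≈ extend h y
  extend-cong-≋ {x} {y} h e = begin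
      extend h x
    ≈⟨ sym (extend-via-support x (support x y) h (support-once x y (λ w m → into-support (member-++ˡ w (map proj₂ x) (map proj₂ y) m)))) ⟩
      sumR (λ u → coeff x u * h u) (support x y)
    ≈⟨ sumR-cong (λ u → *-cong (e u) refl) (support x y) ⟩
      sumR (λ u → coeff y u * h u) (support x y)
    ≈⟨ extend-via-support y (support x y) h (support-once x y (λ w m → into-support (member-++ʳ w (map proj₂ x) (map proj₂ y) m))) ⟩
      extend h y
    ∎
    where
    into-support : ∀ {w} → member w (map proj₂ x ++ map proj₂ y) ≡ true → member w (map proj₂ (x ++ y)) ≡ true
    into-support {w} = P.subst (λ L → member w L ≡ true) (P.sym (map-++ proj₂ x y))

  extend-cong : ∀ {h h' : Word → K} → (∀ w → h w ≈ h' w) → ∀ x → extend h x ≈ extend h' x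
  extend-cong e x = sumR-cong (λ p → *-cong refl (e (proj₂ p))) x

  extend-concatMap : ∀ {a} {X : Set a} h (g : X → Lin) xs → extend h (concatMap g xs) ≈ sumR (λ p → extend h (g p)) xs
  extend-concatMap h g xs = sumR-concatMap _ g xs

  extend-scale : ∀ h k x → extend h (scale k x) ≈ k * extend h x
  extend-scale h k x = begin
      extend h (scale k x)
    ≡⟨ sumR-map (λ p → proj₁ p * h (proj₂ p)) (λ p → (k * proj₁ p , proj₂ p)) x ⟩
      sumR (λ p → (k * proj₁ p) * h (proj₂ p)) x
    ≈⟨ sumR-cong (λ p → *-assoc k (proj₁ p) _) x ⟩
      sumR (λ p → k * (proj₁ p * h (proj₂ p))) x
    ≈⟨ sym (sumR-*ˡ k _ x) ⟩
      k * extend h x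
    ∎

  extend-uniform : ∀ h k (L : List Word) → extend h (map (λ a → (k , a)) L) ≡ sumR (λ a → k * h a) L
  extend-uniform h k L = sumR-map (λ p → proj₁ p * h (proj₂ p)) (λ a → (k , a)) L

  extend-linear : ∀ {a} {X : Set a} (g : X → K) (H : X → Word → K) Q x →
    extend (λ w → sumR (λ q → g q * H q w) Q) x ≈ sumR (λ q → g q * extend (H q) x) Q
  extend-linear g H Q x = begin
      sumR (λ p → proj₁ p * sumR (λ q → g q * H q (proj₂ p)) Q) x
    ≈⟨ sumR-cong (λ p → trans (sumR-*ˡ (proj₁ p) _ Q) (sumR-cong (λ q → trans (sym (*-assoc _ _ _)) (trans (*-cong (*-comm _ _) refl) (*-assoc _ _ _))) Q)) x ⟩
      sumR (λ p → sumR (λ q → g q * (proj₁ p * H q (proj₂ p))) Q) x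
    ≈⟨ sumR-swap _ x Q ⟩
      sumR (λ q → sumR (λ p → g q * (proj₁ p * H q (proj₂ p))) x) Q
    ≈⟨ sumR-cong (λ q → sym (sumR-*ˡ (g q) _ x)) Q ⟩
      sumR (λ q → g q * extend (H q) x) Q
    ∎

  sumR-scaled-indicator : ∀ k w (L : List Word) → sumR (λ a → k * δ w a) L ≈ k * ι (multiplicity w L)
  sumR-scaled-indicator k w L = trans (sym (sumR-*ˡ k _ L)) (*-cong refl (sumR-ι (λ a → [ a == w ]) L))

  coeff-uniform : ∀ k (L : List Word) w → coeff (map (λ a → (k , a)) L) w ≈ k * ι (multiplicity w L)
  coeff-uniform k L w = trans (coeff≈extend-δ (map (λ a → (k , a)) L) w)
    (P.subst (_≈ k * ι (multiplicity w L)) (P.sym (extend-uniform (δ w) k L)) (sumR-scaled-indicator k w L))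

  coeff-P : ∀ σ w → coeff (P σ) w ≈ ι (multiplicity w (PFsOf σ))
  coeff-P σ w = trans (coeff-uniform 1# (PFsOf σ) w) (*-identityˡ _)

  extend-P : ∀ h σ → extend h (P σ) ≈ sumR h (PFsOf σ)
  extend-P h σ = P.subst (_≈ sumR h (PFsOf σ)) (P.sym (extend-uniform h 1# (PFsOf σ))) (sumR-cong (λ a → *-identityˡ _) (PFsOf σ))

  coeff-⊛ : ∀ x y w → coeff (x ⊛ y) w ≈ extend (λ a → extend (λ b → ι (multiplicity w (a ⋒ b))) y) x
  coeff-⊛ x y w = begin
      coeff (x ⊛ y) w
    ≈⟨ coeff≈extend-δ (x ⊛ y) w ⟩
      extend (δ w) (x ⊛ y)
    ≈⟨ extend-concatMap (δ w) _ x ⟩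
      sumR (λ p → extend (δ w) (concatMap (λ q → map (λ a → (proj₁ p * proj₁ q , a)) (proj₂ p ⋒ proj₂ q)) y)) x
    ≈⟨ sumR-cong (λ p → extend-concatMap (δ w) _ y) x ⟩
      sumR (λ p → sumR (λ q → extend (δ w) (map (λ a → (proj₁ p * proj₁ q , a)) (proj₂ p ⋒ proj₂ q))) y) x
    ≈⟨ sumR-cong (λ p → sumR-cong (λ q →
          trans (sym (coeff≈extend-δ (map (λ a → (proj₁ p * proj₁ q , a)) (proj₂ p ⋒ proj₂ q)) w))
                (coeff-uniform (proj₁ p * proj₁ q) (proj₂ p ⋒ proj₂ q) w)) y) x ⟩
      sumR (λ p → sumR (λ q → (proj₁ p * proj₁ q) * ι (multiplicity w (proj₂ p ⋒ proj₂ q))) y) x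
    ≈⟨ sumR-cong (λ p → trans (sumR-cong (λ q → *-assoc _ _ _) y) (sym (sumR-*ˡ (proj₁ p) _ y))) x ⟩
      extend (λ a → extend (λ b → ι (multiplicity w (a ⋒ b))) y) x
    ∎

  P-product : ∀ π' π'' → IsNDPF π' → IsNDPF π'' → P π' ⊛ P π'' ≋ P (π' • π'')
  P-product π' π'' h' h'' w = begin
      coeff (P π' ⊛ P π'') w
    ≈⟨ coeff-⊛ (P π') (P π'') w ⟩
      extend (λ a → extend (λ b → ι (multiplicity w (a ⋒ b))) (P π'')) (P π')
    ≈⟨ extend-cong (λ a → extend-P _ π'') (P π') ⟩
      extend (λ a → sumR (λ b → ι (multiplicity w (a ⋒ b))) (PFsOf π'')) (P π')
    ≈⟨ extend-P _ π' ⟩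
      sumR (λ a → sumR (λ b → ι (multiplicity w (a ⋒ b))) (PFsOf π'')) (PFsOf π')
    ≈⟨ sumR-cong (λ a → sumR-ι _ (PFsOf π'')) (PFsOf π') ⟩
      sumR (λ a → ι (sumN (λ b → multiplicity w (a ⋒ b)) (PFsOf π''))) (PFsOf π')
    ≈⟨ sumR-ι _ (PFsOf π') ⟩
      ι (sumN (λ a → sumN (λ b → multiplicity w (a ⋒ b)) (PFsOf π'')) (PFsOf π'))
    ≡⟨ P.cong ι (P.trans (multiplicity-product π' π'' h' h'' w) (P.sym (multiplicity-PFsOf-NDPF (π' • π'') (NDPF-• π' π'' h' h'') w))) ⟩
      ι (multiplicity w (PFsOf (π' • π'')))
    ≈⟨ sym (coeff-P (π' • π'') w) ⟩
      coeff (P (π' • π'')) w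
    ∎

  ⊛-cong : ∀ {x x' y y'} → x ≋ x' → y ≋ y' → x ⊛ y ≋ x' ⊛ y'
  ⊛-cong {x} {x'} {y} {y'} x≋x' y≋y' w = begin
      coeff (x ⊛ y) w
    ≈⟨ coeff-⊛ x y w ⟩
      extend (λ a → extend (λ b → ι (multiplicity w (a ⋒ b))) y) x
    ≈⟨ extend-cong (λ a → extend-cong-≋ {y} {y'} (λ b → ι (multiplicity w (a ⋒ b))) y≋y') x ⟩
      extend (λ a → extend (λ b → ι (multiplicity w (a ⋒ b))) y') x
    ≈⟨ extend-cong-≋ {x} {x'} (λ a → extend (λ b → ι (multiplicity w (a ⋒ b))) y') x≋x' ⟩
      extend (λ a → extend (λ b → ι (multiplicity w (a ⋒ b))) y') x'
    ≈⟨ sym (coeff-⊛ x' y' w) ⟩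
      coeff (x' ⊛ y') w
    ∎

  coeff₂≡sumR : ∀ x u v → coeff₂ x u v ≡ sumR (λ p → if (proj₁ (proj₂ p) == u) ∧ (proj₂ (proj₂ p) == v) then proj₁ p else 0#) x
  coeff₂≡sumR [] u v = P.refl
  coeff₂≡sumR (p ∷ x) u v = P.cong (_ +_) (coeff₂≡sumR x u v)

  δ₂ : Word → Word → Word → Word → K
  δ₂ u v a b = ι [ (a == u) ∧ (b == v) ]

  extend₂ : (Word → Word → K) → Lin₂ → K
  extend₂ h = sumR (λ p → proj₁ p * h (proj₁ (proj₂ p)) (proj₂ (proj₂ p)))

  coeff₂≈extend₂-δ : ∀ x u v → coeff₂ x u v ≈ extend₂ (δ₂ u v) x
  coeff₂≈extend₂-δ x u v = P.subst (_≈ extend₂ (δ₂ u v) x) (P.sym (coeff₂≡sumR x u v))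
    (sumR-cong (λ p → if-ι ((proj₁ (proj₂ p) == u) ∧ (proj₂ (proj₂ p) == v)) (proj₁ p)) x)

  ι[∧] : ∀ a b → ι [ a ∧ b ] ≈ ι [ a ] * ι [ b ]
  ι[∧] a b = P.subst (λ n → ι n ≈ ι [ a ] * ι [ b ]) (P.sym ([∧] a b)) (ι-* [ a ] [ b ])

  coeff₂-concatMap : ∀ {a} {X : Set a} (G : X → Lin₂) L u v → coeff₂ (concatMap G L) u v ≈ sumR (λ l → coeff₂ (G l) u v) L
  coeff₂-concatMap G L u v = trans (coeff₂≈extend₂-δ (concatMap G L) u v)
    (trans (sumR-concatMap _ G L) (sumR-cong (λ l → sym (coeff₂≈extend₂-δ (G l) u v)) L))

  coeff₂-scale : ∀ k (Z : Lin₂) u v → coeff₂ (map (λ q → (k * proj₁ q , proj₂ q)) Z) u v ≈ k * coeff₂ Z u v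
  coeff₂-scale k Z u v = begin
      coeff₂ (map (λ q → (k * proj₁ q , proj₂ q)) Z) u v
    ≈⟨ coeff₂≈extend₂-δ (map (λ q → (k * proj₁ q , proj₂ q)) Z) u v ⟩
      extend₂ (δ₂ u v) (map (λ q → (k * proj₁ q , proj₂ q)) Z)
    ≡⟨ sumR-map (λ p → proj₁ p * δ₂ u v (proj₁ (proj₂ p)) (proj₂ (proj₂ p))) (λ q → (k * proj₁ q , proj₂ q)) Z ⟩
      sumR (λ q → (k * proj₁ q) * δ₂ u v (proj₁ (proj₂ q)) (proj₂ (proj₂ q))) Z
    ≈⟨ sumR-cong (λ q → *-assoc _ _ _) Z ⟩
      sumR (λ q → k * (proj₁ q * δ₂ u v (proj₁ (proj₂ q)) (proj₂ (proj₂ q)))) Z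
    ≈⟨ sym (sumR-*ˡ k _ Z) ⟩
      k * extend₂ (δ₂ u v) Z
    ≈⟨ *-cong refl (sym (coeff₂≈extend₂-δ Z u v)) ⟩
      k * coeff₂ Z u v
    ∎

  coeff₂-⊗ : ∀ x y u v → coeff₂ (x ⊗ y) u v ≈ coeff x u * coeff y v
  coeff₂-⊗ x y u v = begin
      coeff₂ (x ⊗ y) u v
    ≈⟨ coeff₂≈extend₂-δ (x ⊗ y) u v ⟩
      extend₂ (δ₂ u v) (x ⊗ y)
    ≈⟨ sumR-concatMap _ (λ p → map (λ q → (proj₁ p * proj₁ q , proj₂ p , proj₂ q)) y) x ⟩
      sumR (λ p → extend₂ (δ₂ u v) (map (λ q → (proj₁ p * proj₁ q , proj₂ p , proj₂ q)) y)) x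
    ≈⟨ sumR-cong (λ p → reflexive (sumR-map (λ r → proj₁ r * δ₂ u v (proj₁ (proj₂ r)) (proj₂ (proj₂ r))) (λ q → (proj₁ p * proj₁ q , proj₂ p , proj₂ q)) y)) x ⟩
      sumR (λ p → sumR (λ q → (proj₁ p * proj₁ q) * δ₂ u v (proj₂ p) (proj₂ q)) y) x
    ≈⟨ sumR-cong (λ p → sumR-cong (λ q → trans (*-cong refl (ι[∧] (proj₂ p == u) (proj₂ q == v))) (*-interchange (proj₁ p) (proj₁ q) _ _)) y) x ⟩
      sumR (λ p → sumR (λ q → (proj₁ p * δ u (proj₂ p)) * (proj₁ q * δ v (proj₂ q))) y) x
    ≈⟨ sumR-cong (λ p → sym (sumR-*ˡ _ _ y)) x ⟩
      sumR (λ p → (proj₁ p * δ u (proj₂ p)) * extend (δ v) y) x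
    ≈⟨ sym (sumR-*ʳ _ _ x) ⟩
      extend (δ u) x * extend (δ v) y
    ≈⟨ *-cong (sym (coeff≈extend-δ x u)) (sym (coeff≈extend-δ y v)) ⟩
      coeff x u * coeff y v
    ∎

  coeff₂-Δ : ∀ x a b → coeff₂ (Δ x) a b ≈ extend (λ w → ι (splitsParkingTo a b w)) x
  coeff₂-Δ x a b = begin
      coeff₂ (Δ x) a b
    ≈⟨ coeff₂-concatMap terms x a b ⟩
      sumR (λ p → coeff₂ (terms p) a b) x
    ≈⟨ sumR-cong (λ p → trans (coeff₂≈extend₂-δ (terms p) a b) (reflexive (sumR-map _ (term p) (splits (proj₂ p))))) x ⟩
      sumR (λ p → sumR (λ uv → proj₁ p * δ₂ a b (Park (proj₁ uv)) (Park (proj₂ uv))) (splits (proj₂ p))) x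
    ≈⟨ sumR-cong (λ p → trans (sym (sumR-*ˡ (proj₁ p) _ (splits (proj₂ p)))) (*-cong refl (parking-count (proj₂ p)))) x ⟩
      extend (λ w → ι (splitsParkingTo a b w)) x
    ∎
    where
    term : K × Word → Word × Word → K × Word × Word
    term p uv = proj₁ p , Park (proj₁ uv) , Park (proj₂ uv)
    terms : K × Word → Lin₂
    terms p = map (term p) (splits (proj₂ p))
    parking-count : ∀ w → sumR (λ uv → δ₂ a b (Park (proj₁ uv)) (Park (proj₂ uv))) (splits w) ≈ ι (splitsParkingTo a b w)
    parking-count w = trans (sumR-cong (λ uv → reflexive (P.cong ι ([∧] (Park (proj₁ uv) == a) (Park (proj₂ uv) == b)))) (splits w))
                            (sumR-ι (λ uv → parksTo a b (proj₁ uv) (proj₂ uv)) (splits w))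

  coeff₂-swap : ∀ Z u v → coeff₂ (swap₂ Z) u v ≈ coeff₂ Z v u
  coeff₂-swap [] u v = refl
  coeff₂-swap (p ∷ Z) u v =
    +-cong (reflexive (P.cong (λ b → if b then proj₁ p else 0#) (∧-comm (proj₂ (proj₂ p) == u) (proj₁ (proj₂ p) == v)))) (coeff₂-swap Z u v)

  coeff₂-ΔP : ∀ π a b → coeff₂ (Δ (P π)) a b ≈ ι (ΔPCount π a b)
  coeff₂-ΔP π a b = trans (coeff₂-Δ (P π) a b) (trans (extend-P _ π) (sumR-ι (splitsParkingTo a b) (PFsOf π)))

  P-coproduct : ∀ π → IsNDPF π → Δ (P π) ≋₂ concatMap (λ uv → P (Park (proj₁ uv)) ⊗ P (Park (proj₂ uv))) (ndPairs π)
  P-coproduct π h a b = begin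
      coeff₂ (Δ (P π)) a b
    ≈⟨ coeff₂-ΔP π a b ⟩
      ι (ΔPCount π a b)
    ≡⟨ P.cong ι (ΔPCount≡ndPairsCount π a b h) ⟩
      ι (ndPairsCount π a b)
    ≈⟨ sym (sumR-ι (λ uv → PCoeffOfPark a (proj₁ uv) ℕ.* PCoeffOfPark b (proj₂ uv)) (ndPairs π)) ⟩
      sumR (λ uv → ι (PCoeffOfPark a (proj₁ uv) ℕ.* PCoeffOfPark b (proj₂ uv))) (ndPairs π)
    ≈⟨ sumR-cong (λ uv → trans (ι-* (PCoeffOfPark a (proj₁ uv)) (PCoeffOfPark b (proj₂ uv))) (sym (trans (coeff₂-⊗ (P (Park (proj₁ uv))) (P (Park (proj₂ uv))) a b)
          (*-cong (coeff-P (Park (proj₁ uv)) a) (coeff-P (Park (proj₂ uv)) b))))) (ndPairs π) ⟩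
      sumR (λ uv → coeff₂ (P (Park (proj₁ uv)) ⊗ P (Park (proj₂ uv))) a b) (ndPairs π)
    ≈⟨ sym (coeff₂-concatMap (λ uv → P (Park (proj₁ uv)) ⊗ P (Park (proj₂ uv))) (ndPairs π) a b) ⟩
      coeff₂ (concatMap (λ uv → P (Park (proj₁ uv)) ⊗ P (Park (proj₂ uv))) (ndPairs π)) a b
    ∎

  -- CQSym and the semigroup algebra of nondecreasing parking functions

  extend-linP : ∀ h s → extend h (linP s) ≈ sumR (λ p → proj₁ p * extend h (P (proj₂ p))) s
  extend-linP h s = trans (extend-concatMap h (λ p → scale (proj₁ p) (P (proj₂ p))) s) (sumR-cong (λ p → extend-scale h (proj₁ p) (P (proj₂ p))) s)

  coeff-linP : ∀ s w → coeff (linP s) w ≈ sumR (λ p → proj₁ p * coeff (P (proj₂ p)) w) s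
  coeff-linP s w = trans (coeff≈extend-δ (linP s) w) (trans (extend-linP (δ w) s) (sumR-cong (λ p → *-cong refl (sym (coeff≈extend-δ (P (proj₂ p)) w))) s))

  coeff-scale : ∀ k x w → coeff (scale k x) w ≈ k * coeff x w
  coeff-scale k x w = trans (coeff≈extend-δ (scale k x) w) (trans (extend-scale (δ w) k x) (*-cong refl (sym (coeff≈extend-δ x w))))

  ValidS-⋆ : ∀ s t → ValidS s → ValidS t → ValidS (s ⋆ t)
  ValidS-⋆ s t vs vt = All-concatMap (λ p → map (λ q → (proj₁ p * proj₁ q , proj₂ p • proj₂ q)) t) s
    (All.map (λ {p} hp → AllP.map⁺ (All.map (λ {q} hq → NDPF-• (proj₂ p) (proj₂ q) hp hq) vt)) vs)

  linP-⋆ : ∀ s t → ValidS s → ValidS t → linP (s ⋆ t) ≋ linP s ⊛ linP t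
  linP-⋆ s t vs vt w = begin
      coeff (linP (s ⋆ t)) w
    ≈⟨ coeff-linP (s ⋆ t) w ⟩
      sumR (λ r → proj₁ r * coeff (P (proj₂ r)) w) (s ⋆ t)
    ≈⟨ sumR-concatMap _ (λ p → map (λ q → (proj₁ p * proj₁ q , proj₂ p • proj₂ q)) t) s ⟩
      sumR (λ p → sumR (λ r → proj₁ r * coeff (P (proj₂ r)) w) (map (λ q → (proj₁ p * proj₁ q , proj₂ p • proj₂ q)) t)) s
    ≈⟨ sumR-cong (λ p → trans (reflexive (sumR-map (λ r → proj₁ r * coeff (P (proj₂ r)) w) (λ q → (proj₁ p * proj₁ q , proj₂ p • proj₂ q)) t))
          (trans (sumR-cong (λ q → *-assoc _ _ _) t) (sym (sumR-*ˡ (proj₁ p) _ t)))) s ⟩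
      sumR (λ p → proj₁ p * sumR (λ q → proj₁ q * coeff (P (proj₂ p • proj₂ q)) w) t) s
    ≈⟨ sumR-All (All.map (λ {p} hp → *-cong refl (sumR-All (All.map (λ {q} hq → *-cong refl (sym (P-product (proj₂ p) (proj₂ q) hp hq w))) vt))) vs) ⟩
      sumR (λ p → proj₁ p * sumR (λ q → proj₁ q * coeff (P (proj₂ p) ⊛ P (proj₂ q)) w) t) s
    ≈⟨ sumR-cong (λ p → *-cong refl (sumR-cong (λ q → *-cong refl (coeff-⊛ (P (proj₂ p)) (P (proj₂ q)) w)) t)) s ⟩
      sumR (λ p → proj₁ p * sumR (λ q → proj₁ q * extend (λ a → extend (shuffleCount a) (P (proj₂ q))) (P (proj₂ p))) t) s
    ≈⟨ sumR-cong (λ p → *-cong refl (sym (extend-linear proj₁ (λ q a → extend (shuffleCount a) (P (proj₂ q))) t (P (proj₂ p))))) s ⟩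
      sumR (λ p → proj₁ p * extend (λ a → sumR (λ q → proj₁ q * extend (shuffleCount a) (P (proj₂ q))) t) (P (proj₂ p))) s
    ≈⟨ sym (extend-linP _ s) ⟩
      extend (λ a → sumR (λ q → proj₁ q * extend (shuffleCount a) (P (proj₂ q))) t) (linP s)
    ≈⟨ extend-cong (λ a → sym (extend-linP (shuffleCount a) t)) (linP s) ⟩
      extend (λ a → extend (shuffleCount a) (linP t)) (linP s)
    ≈⟨ sym (coeff-⊛ (linP s) (linP t) w) ⟩
      coeff (linP s ⊛ linP t) w
    ∎
    where
    shuffleCount : Word → Word → K
    shuffleCount a b = ι (multiplicity w (a ⋒ b))

  linP-oneS : linP oneS ≋ one
  linP-oneS w with [] == w
  ... | true = +-cong (*-identityʳ 1#) refl
  ... | false = refl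

  ValidS-oneS : ValidS oneS
  ValidS-oneS = (_ , _) ∷ []

  linP-cong : ∀ s t → s ≈S t → linP s ≋ linP t
  linP-cong s t e w = trans (coeff≈extend-δ (linP s) w) (trans (extend-linP (δ w) s)
    (trans (extend-cong-≋ {s} {t} (λ π → extend (δ w) (P π)) e) (sym (trans (coeff≈extend-δ (linP t) w) (extend-linP (δ w) t)))))

  coeff-P-at-NDPF : ∀ σ π → IsNDPF σ → IsNDPF π → coeff (P σ) π ≈ δ π σ
  coeff-P-at-NDPF σ π hσ hπ = trans (coeff-P σ π)
    (reflexive (P.cong ι (P.trans (multiplicity-PFsOf-NDPF σ hσ π) (P.cong (λ z → [ z ]) (P.trans (P.cong (_== σ) (IsNDPF-sort {π} hπ)) (==-sym π σ))))))

  coeffS-valid : ∀ s π → ValidS s → IsNDPF π → coeff (linP s) π ≈ coeff s π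
  coeffS-valid s π vs hπ = begin
      coeff (linP s) π
    ≈⟨ coeff-linP s π ⟩
      sumR (λ p → proj₁ p * coeff (P (proj₂ p)) π) s
    ≈⟨ sumR-All (All.map (λ {p} hp → *-cong refl (coeff-P-at-NDPF (proj₂ p) π hp hπ)) vs) ⟩
      extend (δ π) s
    ≈⟨ sym (coeff≈extend-δ s π) ⟩
      coeff s π
    ∎

  coeffS-invalid : ∀ s π → ValidS s → ¬ IsNDPF π → coeff s π ≈ 0#
  coeffS-invalid s π vs nπ = trans (coeff≈extend-δ s π) (extend-δ-valid vs)
    where
    extend-δ-valid : ∀ {z} → ValidS z → extend (δ π) z ≈ 0#
    extend-δ-valid [] = refl
    extend-δ-valid {p ∷ z} (hp ∷ hs) = trans (+-cong (trans (*-cong refl (reflexive (P.cong (λ b → ι [ b ]) π≢))) (zeroʳ _)) (extend-δ-valid hs))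
      (+-identityˡ _)
      where π≢ = ==-ne (proj₂ p) π (λ e → nπ (P.subst IsNDPF e hp))

  IsNDPF-dec : ∀ π → IsNDPF π ⊎ ¬ IsNDPF π
  IsNDPF-dec π with isPF π in e1 | isNondecreasing π in e2
  ... | true | true = inj₁ (_ , _)
  ... | false | _ = inj₂ (λ h → proj₁ h)
  ... | true | false = inj₂ (λ h → proj₂ h)

  linP-injective : ∀ s t → ValidS s → ValidS t → linP s ≋ linP t → s ≈S t
  linP-injective s t vs vt e π with IsNDPF-dec π
  ... | inj₁ h = trans (sym (coeffS-valid s π vs h)) (trans (e π) (coeffS-valid t π vt h))
  ... | inj₂ n = trans (coeffS-invalid s π vs n) (sym (coeffS-invalid t π vt n))

  linP-++ : ∀ s t → linP (s ++ t) ≋ linP s ++ linP t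
  linP-++ s t w = reflexive (P.cong (λ z → coeff z w) (concatMap-++ (λ p → scale (proj₁ p) (P (proj₂ p))) s t))

  linP-scaleS : ∀ k s → linP (scaleS k s) ≋ scale k (linP s)
  linP-scaleS k s w = begin
      coeff (linP (scaleS k s)) w
    ≈⟨ coeff-linP (scaleS k s) w ⟩
      sumR (λ p → proj₁ p * coeff (P (proj₂ p)) w) (scaleS k s)
    ≡⟨ sumR-map (λ p → proj₁ p * coeff (P (proj₂ p)) w) (λ p → (k * proj₁ p , proj₂ p)) s ⟩
      sumR (λ p → (k * proj₁ p) * coeff (P (proj₂ p)) w) s
    ≈⟨ sumR-cong (λ p → *-assoc _ _ _) s ⟩
      sumR (λ p → k * (proj₁ p * coeff (P (proj₂ p)) w)) s
    ≈⟨ sym (sumR-*ˡ k _ s) ⟩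
      k * sumR (λ p → proj₁ p * coeff (P (proj₂ p)) w) s
    ≈⟨ *-cong refl (sym (coeff-linP s w)) ⟩
      k * coeff (linP s) w
    ≈⟨ sym (coeff-scale k (linP s) w) ⟩
      coeff (scale k (linP s)) w
    ∎

  All-if : ∀ {X : Set} {Q : X → Set} (c : Bool) (p : X) → (c ≡ true → Q p) → All Q (if c then p ∷ [] else [])
  All-if true p f = f P.refl ∷ []
  All-if false p f = []

  ndPairs-IsNDPF : ∀ π → All (λ uv → IsNDPF (Park (proj₁ uv)) × IsNDPF (Park (proj₂ uv))) (ndPairs π)
  ndPairs-IsNDPF π = All-concatMap pairsAt (upTo (suc n)) (All.map (λ {k} _ →
      All-concatMap (pairsFrom k) (words k n) (All.map (λ {u} hu →
        All-concatMap (keepPair u) (words (n ℕ.∸ k) n) (All.map (λ {v} hv →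
          All-if (isNondecreasing u ∧ isNondecreasing v ∧ (sort (u ++ v) == π)) (u , v)
            (λ e → Park-IsNDPF (nondecreasing⇒Sorted u (≡true⇒T (∧-true₁ _ _ e))) (InWords-positive hu)
                 , Park-IsNDPF (nondecreasing⇒Sorted v (≡true⇒T (∧-true₁ _ _ (∧-true₂ (isNondecreasing u) _ e)))) (InWords-positive hv)))
          (words-InWords (n ℕ.∸ k) n))) (words-InWords k n))) (upTo-All (suc n)))
    where
    n = length π
    keepPair : Word → Word → List (Word × Word)
    keepPair u v = if isNondecreasing u ∧ isNondecreasing v ∧ (sort (u ++ v) == π) then (u , v) ∷ [] else []
    pairsFrom : ℕ → Word → List (Word × Word)
    pairsFrom k u = concatMap (keepPair u) (words (n ℕ.∸ k) n)
    pairsAt : ℕ → List (Word × Word)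
    pairsAt k = concatMap (pairsFrom k) (words k n)

  coeff₂-Δ-linP : ∀ x s → x ≋ linP s → ∀ a b → coeff₂ (Δ x) a b ≈ sumR (λ p → proj₁ p * coeff₂ (Δ (P (proj₂ p))) a b) s
  coeff₂-Δ-linP x s x≋s a b = trans (coeff₂-Δ x a b) (trans (extend-cong-≋ {x} {linP s} (λ w → ι (splitsParkingTo a b w)) x≋s)
    (trans (extend-linP _ s) (sumR-cong (λ p → *-cong refl (sym (coeff₂-Δ (P (proj₂ p)) a b))) s)))

  ΔlinP-term : K × Word → Word × Word → K × Word × Word
  ΔlinP-term p uv = proj₁ p , Park (proj₁ uv) , Park (proj₂ uv)

  ΔlinP-terms : SAlg → Lin₂
  ΔlinP-terms s = concatMap (λ p → map (ΔlinP-term p) (ndPairs (proj₂ p))) s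

  P⊗P-combination : Lin₂ → Lin₂
  P⊗P-combination z = concatMap (λ p → map (λ q → (proj₁ p * proj₁ q , proj₂ q)) (P (proj₁ (proj₂ p)) ⊗ P (proj₂ (proj₂ p)))) z

  Δ-InCQSym₂ : ∀ x → InCQSym x → InCQSym₂ (Δ x)
  Δ-InCQSym₂ x (s , vs , x≋s) = ΔlinP-terms s , terms-valid , Δx≋
    where
    terms-valid : All (λ p → IsNDPF (proj₁ (proj₂ p)) × IsNDPF (proj₂ (proj₂ p))) (ΔlinP-terms s)
    terms-valid = All-concatMap (λ p → map (ΔlinP-term p) (ndPairs (proj₂ p))) s
      (All.map (λ {p} _ → AllP.map⁺ (ndPairs-IsNDPF (proj₂ p))) vs)
    C : Word → Word → K × Word × Word → K
    C a b r = proj₁ r * coeff₂ (P (proj₁ (proj₂ r)) ⊗ P (proj₂ (proj₂ r))) a b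
    Δx≋ : Δ x ≋₂ P⊗P-combination (ΔlinP-terms s)
    Δx≋ a b = begin
        coeff₂ (Δ x) a b
      ≈⟨ coeff₂-Δ-linP x s x≋s a b ⟩
        sumR (λ p → proj₁ p * coeff₂ (Δ (P (proj₂ p))) a b) s
      ≈⟨ sumR-All (All.map (λ {p} hp → *-cong refl (trans (P-coproduct (proj₂ p) hp a b) (coeff₂-concatMap _ (ndPairs (proj₂ p)) a b))) vs) ⟩
        sumR (λ p → proj₁ p * sumR (λ uv → coeff₂ (P (Park (proj₁ uv)) ⊗ P (Park (proj₂ uv))) a b) (ndPairs (proj₂ p))) s
      ≈⟨ sumR-cong (λ p → trans (sumR-*ˡ (proj₁ p) _ (ndPairs (proj₂ p))) (reflexive (P.sym (sumR-map (C a b) (ΔlinP-term p) (ndPairs (proj₂ p)))))) s ⟩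
        sumR (λ p → sumR (C a b) (map (ΔlinP-term p) (ndPairs (proj₂ p)))) s
      ≈⟨ sym (sumR-concatMap (C a b) (λ p → map (ΔlinP-term p) (ndPairs (proj₂ p))) s) ⟩
        sumR (C a b) (ΔlinP-terms s)
      ≈⟨ sumR-cong (λ r → sym (coeff₂-scale (proj₁ r) (P (proj₁ (proj₂ r)) ⊗ P (proj₂ (proj₂ r))) a b)) (ΔlinP-terms s) ⟩
        sumR (λ r → coeff₂ (map (λ q → (proj₁ r * proj₁ q , proj₂ q)) (P (proj₁ (proj₂ r)) ⊗ P (proj₂ (proj₂ r)))) a b) (ΔlinP-terms s)
      ≈⟨ sym (coeff₂-concatMap _ (ΔlinP-terms s) a b) ⟩
        coeff₂ (P⊗P-combination (ΔlinP-terms s)) a b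
      ∎

  coeff₂-ΔP-sym : ∀ π → IsNDPF π → ∀ {a b} → coeff₂ (Δ (P π)) a b ≈ coeff₂ (Δ (P π)) b a
  coeff₂-ΔP-sym π h {a} {b} = trans (coeff₂-ΔP π a b) (trans (reflexive (P.cong ι (ΔPCount-sym π a b h))) (sym (coeff₂-ΔP π b a)))

  Δ-cocommutative : ∀ x → InCQSym x → Δ x ≋₂ swap₂ (Δ x)
  Δ-cocommutative x (s , vs , x≋s) a b = begin
      coeff₂ (Δ x) a b
    ≈⟨ coeff₂-Δ-linP x s x≋s a b ⟩
      sumR (λ p → proj₁ p * coeff₂ (Δ (P (proj₂ p))) a b) s
    ≈⟨ sumR-All (All.map (λ {p} hp → *-cong refl (coeff₂-ΔP-sym (proj₂ p) hp)) vs) ⟩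
      sumR (λ p → proj₁ p * coeff₂ (Δ (P (proj₂ p))) b a) s
    ≈⟨ sym (coeff₂-Δ-linP x s x≋s b a) ⟩
      coeff₂ (Δ x) b a
    ≈⟨ sym (coeff₂-swap (Δ x) a b) ⟩
      coeff₂ (swap₂ (Δ x)) a b
    ∎

  InCQSym-one : InCQSym one
  InCQSym-one = oneS , ValidS-oneS , (λ w → sym (linP-oneS w))

  InCQSym-⊛ : ∀ x y → InCQSym x → InCQSym y → InCQSym (x ⊛ y)
  InCQSym-⊛ x y (s , vs , x≋s) (t , vt , y≋t) =
    s ⋆ t , ValidS-⋆ s t vs vt , (λ w → trans (⊛-cong {x} {linP s} {y} {linP t} x≋s y≋t w) (sym (linP-⋆ s t vs vt w)))

  linP-InCQSym : ∀ s → ValidS s → InCQSym (linP s)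
  linP-InCQSym s vs = s , vs , (λ w → refl)

open Combinatorics using (NDPF-•)

mainTheorem14 : ∀ {c ℓ} (K : CharZeroField c ℓ) →
  let open PQSym (CharZeroField.commutativeRing K) in
  -- product: P^π' P^π'' = P^(π' • π'')
  (∀ π' π'' → IsNDPF π' → IsNDPF π'' → P π' ⊛ P π'' ≋ P (π' • π''))
  -- coproduct: Δ P^π = Σ_{(u,v)} P^Park(u) ⊗ P^Park(v)
  × (∀ π → IsNDPF π →
       Δ (P π) ≋₂ concatMap (λ uv → P (Park (proj₁ uv)) ⊗ P (Park (proj₂ uv))) (ndPairs π))
  -- CQSym is a (Hopf) subalgebra: contains 1, closed under product and coproduct
  × InCQSym one
  × (∀ x y → InCQSym x → InCQSym y → InCQSym (x ⊛ y))
  × (∀ x → InCQSym x → InCQSym₂ (Δ x))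
  -- CQSym is cocommutative
  × (∀ x → InCQSym x → Δ x ≋₂ swap₂ (Δ x))
  -- nondecreasing parking functions form a semigroup under •
  × (∀ π' π'' → IsNDPF π' → IsNDPF π'' → IsNDPF (π' • π''))
  -- CQSym is isomorphic, as an algebra, to the semigroup algebra of (NDPF, •)
  × Σ (SAlg → Lin) (λ φ →
      (∀ s t → ValidS s → ValidS t → s ≈S t → φ s ≋ φ t)
      × (∀ s t → ValidS s → ValidS t → φ s ≋ φ t → s ≈S t)
      × (∀ s t → ValidS s → ValidS t → φ (s ++ t) ≋ φ s ++ φ t)
      × (∀ k s → ValidS s → φ (scaleS k s) ≋ scale k (φ s))
      × (∀ s t → ValidS s → ValidS t → φ (s ⋆ t) ≋ φ s ⊛ φ t)
      × φ oneS ≋ one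
      × (∀ s → ValidS s → InCQSym (φ s))
      × (∀ x → InCQSym x → Σ SAlg (λ s → ValidS s × x ≋ φ s)))
mainTheorem14 K =
    P-product , P-coproduct , InCQSym-one , InCQSym-⊛ , Δ-InCQSym₂ , Δ-cocommutative , NDPF-•
  , linP , (λ s t _ _ → linP-cong s t) , linP-injective , (λ s t _ _ → linP-++ s t) , (λ k s _ → linP-scaleS k s)
  , linP-⋆ , linP-oneS , linP-InCQSym , (λ x x∈CQSym → x∈CQSym)
  where
  R = CharZeroField.commutativeRing K
  open Coefficients R
  open PQSym R using (linP)
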